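{- Let $s\geq 1$, $k\geq 1$ and $p\geq 1$ be integers, let $n_1,\dots,n_p$ be positive integers, let $j\in\{1,\dots,p\}$ be such that $n_j\geq sk+1$, and suppose $n_i\geq sk$ for all $i=1,\dots,p$. Let $(a,j)\in[n_j]\times\{j\}$ and \[ \mathcal{A}_{(a,j)}^{s,k}(n_1,\dots,n_p)=\{A\in[n_1,\dots,n_p]_k^s:\ (a,j)\in A\}. \] Then, with $N=\sum_{i=1}^p n_i$, \[ \left|\mathcal{A}_{(a,j)}^{s,k}(n_1,\dots,n_p)\right| = \binom{N-sk-1}{k-1}. \]
   Context: For positive integers $n_1,\dots,n_p$, let $[n]=\{1,\dots,n\}$ and $[n_1,\dots,n_p]=([n_1]\times\{1\})\cup\cdots\cup([n_p]\times\{p\})$; the elements with second coordinate $i$ are regarded as arranged in cyclic order $1,2,\dots,n_i$ around the $i$-th circle (so $n_i$ is followed by $1$). A subset of $[n_1,\dots,n_p]$ is $s$-separated if no two of its elements lie in the same circle with fewer than $s$ elements of that circle between them; i.e. for any two distinct elements $(a,i),(b,i)$ of the set in the same circle of size $n_i$, both $|a-b|-1\geq s$ and $n_i-|a-b|-1\geq s$. Elements in different circles impose no restriction. $[n_1,\dots,n_p]_k^s$ denotes the set of $s$-separated $k$-element subsets of $[n_1,\dots,n_p]$. -}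

module Defs where

open import Data.Bool using (Bool; true; false; _∧_; not)
open import Data.Nat using (ℕ; zero; suc; _+_; _≤ᵇ_; _≡ᵇ_; ∣_-_∣)
open import Data.Fin using (Fin; zero; suc; toℕ)
open import Data.Fin.Subset using (Subset; inside; outside; ∣_∣)
open import Data.Vec using (Vec; []; _∷_; lookup)
open import Data.List using (List; []; _∷_; [_]; map; concatMap; allFin; length)
open import Data.Bool.ListAction using (and)
open import Data.Nat.ListAction using (sum)
open import Function using (_∘_)
import Data.List as List

all : ∀ {A : Set} → (A → Bool) → List A → Bool
all P xs = and (map P xs)

filter : ∀ {A : Set} → (A → Bool) → List A → List A
filter P [] = []
filter P (x ∷ xs) with P x
... | true = x ∷ filter P xs
... | false = filter P xs

-- The ground set [n_1,...,n_p]: circle i (i : Fin p) has n i points, the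
-- point (a,i) being represented by a : Fin (n i) (a = 0 stands for 1, etc.).
-- A subset of [n_1,...,n_p] is given circle-wise: one Subset (n i) per circle.
Family : (p : ℕ) → (Fin p → ℕ) → Set
Family p n = (i : Fin p) → Subset (n i)

allSubsets : (m : ℕ) → List (Subset m)
allSubsets zero = [ [] ]
allSubsets (suc m) = concatMap (λ v → List._∷_ (inside ∷ v) (List._∷_ (outside ∷ v) List.[])) (allSubsets m)

consF : ∀ {p} {n : Fin (suc p) → ℕ} → Subset (n zero) → Family p (n ∘ suc) → Family (suc p) n
consF S R zero = S
consF S R (suc i) = R i

allFamilies : (p : ℕ) (n : Fin p → ℕ) → List (Family p n)
allFamilies zero n = [ (λ ()) ]
allFamilies (suc p) n =
  concatMap (λ S → map (consF S) (allFamilies p (n ∘ suc))) (allSubsets (n zero))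

card : ∀ {p} {n : Fin p → ℕ} → Family p n → ℕ
card {p} A = sum (map (λ i → ∣ A i ∣) (allFin p))

-- two distinct positions a ≠ b on a circle of size m have at least s points
-- between them in both directions:  |a-b| - 1 ≥ s  and  m - |a-b| - 1 ≥ s
farApart : (s m : ℕ) → ℕ → ℕ → Bool
farApart s m a b = (suc s ≤ᵇ ∣ a - b ∣) ∧ (suc s + ∣ a - b ∣ ≤ᵇ m)

_⇒ᵇ_ : Bool → Bool → Bool
true ⇒ᵇ b = b
false ⇒ᵇ b = true

separated : ∀ {p} {n : Fin p → ℕ} → ℕ → Family p n → Bool
separated {p} {n} s A =
  all (λ i → all (λ x → all (λ y →
        ((lookup (A i) x ∧ lookup (A i) y) ∧ not (toℕ x ≡ᵇ toℕ y))
          ⇒ᵇ farApart s (n i) (toℕ x) (toℕ y))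
      (allFin (n i))) (allFin (n i))) (allFin p)

member : ∀ {p} {n : Fin p → ℕ} → (j : Fin p) → Fin (n j) → Family p n → Bool
member j a A = lookup (A j) a

𝒜 : (s k p : ℕ) (n : Fin p → ℕ) (j : Fin p) (a : Fin (n j)) → List (Family p n)
𝒜 s k p n j a =
  filter (λ A → (separated s A ∧ (card A ≡ᵇ k)) ∧ member j a A) (allFamilies p n)

total : (p : ℕ) → (Fin p → ℕ) → ℕ
total p n = sum (map n (allFin p))

module Submission where

-- On a single circle of m points let f(m,i) count the s-separated
-- i-subsets and g(m,a,i) those containing the point a.  Splitting off one
-- circle at a time, the counts on [n_1,...,n_p] are convolutions (in the size)
-- of these one-circle counts.  On one circle, g does not depend on a
-- (rotation), a set through 0 is 0 plus a "linear" separated set, which gives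
-- g(L+1,0,i+1) = C(L - s(i+1), i), and double counting gives m·g = i·f.
-- So for m ≥ si + 1 the counts are the coefficients F m i, G m i of explicit
-- binomial series (CycleSeries), and these satisfy the Vandermonde-type laws
-- F n ⋆ F N = F (n+N) and G n ⋆ F N = G (n+N), proved over ℤ by induction on
-- N using a Pascal-type recurrence.  Summing up over the circles yields
-- |𝒜| = G N k = C(N - sk - 1, k - 1).

open import Data.Nat using (ℕ; _≤_)

-- Defined recursively (rather than
-- using the library's n C k directly) so that Pascal's rule holds by
-- computation; choose≡C transfers results to the library's definition.
module Binomial where

  open import Data.Nat using (ℕ; zero; suc; _+_; _*_)
  open import Data.Nat.Combinatorics
    using (_C_; nCk+nC[k+1]≡[n+1]C[k+1]; nCn≡1; nC1≡n)
  open import Data.Nat.Properties using (*-distribˡ-+; +-comm; *-zeroʳ)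
  import Data.Nat.Tactic.RingSolver as ℕ-Solver
  open import Relation.Binary.PropositionalEquality
  open ≡-Reasoning

  choose : ℕ → ℕ → ℕ
  choose n zero = 1
  choose zero (suc k) = 0
  choose (suc n) (suc k) = choose n k + choose n (suc k)

  choose≡C : ∀ n k → choose n k ≡ n C k
  choose≡C n zero = refl
  choose≡C zero (suc k) = refl
  choose≡C (suc n) (suc k) =
    trans (cong₂ _+_ (choose≡C n k) (choose≡C n (suc k))) (nCk+nC[k+1]≡[n+1]C[k+1] n k)

  choose-diag : ∀ n → choose n n ≡ 1
  choose-diag n = trans (choose≡C n n) (nCn≡1 n)

  choose-one : ∀ n → choose n 1 ≡ n
  choose-one n = trans (choose≡C n 1) (nC1≡n n)

  choose-absorb : ∀ n k → suc k * choose (suc n) (suc k) ≡ suc n * choose n k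
  choose-absorb zero zero = refl
  choose-absorb zero (suc k) = *-zeroʳ (suc (suc k))
  choose-absorb (suc n) zero =
    trans (cong (λ t → 1 * (1 + t)) (choose-one (suc n))) (regroup (suc n))
    where
    regroup : ∀ m → 1 * (1 + m) ≡ suc m * 1
    regroup = ℕ-Solver.solve-∀
  choose-absorb (suc n) (suc k) = begin
    suc (suc k) * (X + Y)                    ≡⟨ *-distribˡ-+ (suc (suc k)) X Y ⟩
    (X + suc k * X) + suc (suc k) * Y        ≡⟨ cong₂ (λ u v → (X + u) + v) (choose-absorb n k) (choose-absorb n (suc k)) ⟩
    (X + suc n * a) + suc n * b              ≡⟨ regroup a b n ⟩
    suc (suc n) * (a + b)                    ∎
    where
    a = choose n k
    b = choose n (suc k)
    X = choose (suc n) (suc k)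
    Y = choose (suc n) (suc (suc k))
    regroup : ∀ a b n → ((a + b) + suc n * a) + suc n * b ≡ suc (suc n) * (a + b)
    regroup = ℕ-Solver.solve-∀

  choose-ratio : ∀ n k → suc k * choose n (suc k) + suc k * choose n k ≡ suc n * choose n k
  choose-ratio n k = begin
    suc k * choose n (suc k) + suc k * choose n k  ≡⟨ *-distribˡ-+ (suc k) (choose n (suc k)) (choose n k) ⟨
    suc k * (choose n (suc k) + choose n k)        ≡⟨ cong (suc k *_) (+-comm (choose n (suc k)) (choose n k)) ⟩
    suc k * choose (suc n) (suc k)                 ≡⟨ choose-absorb n k ⟩
    suc n * choose n k                             ∎

-- Successor, predecessor and subtraction of
-- naturals are defined by cases on the constructors of ℤ so that C(z,k)
-- evaluates by computation on concrete arguments.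
module IntegerBinomial where

  open import Data.Nat as ℕ using (ℕ; zero; suc)
  import Data.Nat.Properties as ℕP
  open import Data.Integer using (ℤ; +_; -[1+_]; _+_; _*_; -_)
  import Data.Integer.Properties as ℤP
  import Data.Integer.Tactic.RingSolver as ℤ-Solver
  open import Relation.Binary.PropositionalEquality
  open Binomial

  sucℤ : ℤ → ℤ
  sucℤ (+ n) = + suc n
  sucℤ -[1+ zero ] = + 0
  sucℤ -[1+ suc n ] = -[1+ n ]

  predℤ : ℤ → ℤ
  predℤ (+ zero) = -[1+ 0 ]
  predℤ (+ suc n) = + n
  predℤ -[1+ n ] = -[1+ suc n ]

  sucℤ-predℤ : ∀ z → sucℤ (predℤ z) ≡ z
  sucℤ-predℤ (+ zero) = refl
  sucℤ-predℤ (+ suc n) = refl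
  sucℤ-predℤ -[1+ n ] = refl

  predℤ-sucℤ : ∀ z → predℤ (sucℤ z) ≡ z
  predℤ-sucℤ (+ n) = refl
  predℤ-sucℤ -[1+ zero ] = refl
  predℤ-sucℤ -[1+ suc n ] = refl

  infixl 6 _-ⁿ_
  infixr 6 _+ⁿ_

  _-ⁿ_ : ℤ → ℕ → ℤ
  z -ⁿ zero = z
  z -ⁿ suc k = predℤ (z -ⁿ k)

  _+ⁿ_ : ℕ → ℤ → ℤ
  zero +ⁿ z = z
  suc n +ⁿ z = sucℤ (n +ⁿ z)

  sucℤ--ⁿ : ∀ z k → sucℤ z -ⁿ k ≡ sucℤ (z -ⁿ k)
  sucℤ--ⁿ z zero = refl
  sucℤ--ⁿ z (suc k) =
    trans (cong predℤ (sucℤ--ⁿ z k)) (trans (predℤ-sucℤ _) (sym (sucℤ-predℤ _)))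

  -ⁿ-+ : ∀ z a b → (z -ⁿ a) -ⁿ b ≡ z -ⁿ (b ℕ.+ a)
  -ⁿ-+ z a zero = refl
  -ⁿ-+ z a (suc b) = cong predℤ (-ⁿ-+ z a b)

  +ⁿ-sucℤ : ∀ n z → n +ⁿ sucℤ z ≡ sucℤ (n +ⁿ z)
  +ⁿ-sucℤ zero z = refl
  +ⁿ-sucℤ (suc n) z = cong sucℤ (+ⁿ-sucℤ n z)

  +ⁿ--ⁿ : ∀ n z k → n +ⁿ (z -ⁿ k) ≡ (n +ⁿ z) -ⁿ k
  +ⁿ--ⁿ zero z k = refl
  +ⁿ--ⁿ (suc n) z k = trans (cong sucℤ (+ⁿ--ⁿ n z k)) (sym (sucℤ--ⁿ (n +ⁿ z) k))

  +ⁿ-pos : ∀ n m → n +ⁿ + m ≡ + (n ℕ.+ m)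
  +ⁿ-pos zero m = refl
  +ⁿ-pos (suc n) m = cong sucℤ (+ⁿ-pos n m)

  -ⁿ-pos : ∀ n k → + (k ℕ.+ n) -ⁿ k ≡ + n
  -ⁿ-pos n zero = refl
  -ⁿ-pos n (suc k) =
    cong predℤ (trans (cong (λ t → + t -ⁿ k) (sym (ℕP.+-suc k n))) (-ⁿ-pos (suc n) k))

  0-ⁿ : ∀ j → + 0 -ⁿ suc j ≡ -[1+ j ]
  0-ⁿ zero = refl
  0-ⁿ (suc j) = cong predℤ (0-ⁿ j)

  signed : ℕ → ℤ → ℤ
  signed zero x = x
  signed (suc k) x = - signed k x

  signed-+ : ∀ k a b → signed k (a + b) ≡ signed k a + signed k b
  signed-+ zero a b = refl
  signed-+ (suc k) a b =
    trans (cong -_ (signed-+ k a b)) (ℤP.neg-distrib-+ (signed k a) (signed k b))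

  signed-* : ∀ k c a → signed k (c * a) ≡ c * signed k a
  signed-* zero c a = refl
  signed-* (suc k) c a = trans (cong -_ (signed-* k c a)) (ℤP.neg-distribʳ-* c (signed k a))

  -- C(z,k) for integer z:  C(-(n+1), k) = (-1)^k · C(n+k, k).
  zchoose : ℤ → ℕ → ℤ
  zchoose (+ n) k = + choose n k
  zchoose -[1+ n ] k = signed k (+ choose (n ℕ.+ k) k)

  zchoose-0 : ∀ z → zchoose z 0 ≡ + 1
  zchoose-0 (+ n) = refl
  zchoose-0 -[1+ n ] = refl

  zchoose-pascal : ∀ z k → zchoose (sucℤ z) (suc k) ≡ zchoose z (suc k) + zchoose z k
  zchoose-pascal (+ n) k =
    trans (ℤP.pos-+ (choose n k) (choose n (suc k))) (ℤP.+-comm (+ choose n k) (+ choose n (suc k)))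
  zchoose-pascal -[1+ zero ] k = sym (begin
    - signed k (+ choose (suc k) (suc k)) + signed k (+ choose k k)
      ≡⟨ cong₂ (λ u v → - signed k (+ u) + signed k (+ v)) (choose-diag (suc k)) (choose-diag k) ⟩
    - signed k (+ 1) + signed k (+ 1)
      ≡⟨ ℤP.+-inverseˡ (signed k (+ 1)) ⟩
    + 0 ∎)
    where open ≡-Reasoning
  zchoose-pascal -[1+ suc n ] k = sym (begin
    - signed k (+ (Y ℕ.+ X)) + signed k (+ choose (suc n ℕ.+ k) k)
      ≡⟨ cong (λ t → - signed k (+ (Y ℕ.+ X)) + signed k (+ choose t k)) (sym (ℕP.+-suc n k)) ⟩
    - signed k (+ (Y ℕ.+ X)) + signed k (+ Y)
      ≡⟨ cong (λ t → - t + signed k (+ Y)) (trans (cong (signed k) (ℤP.pos-+ Y X)) (signed-+ k (+ Y) (+ X))) ⟩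
    - (signed k (+ Y) + signed k (+ X)) + signed k (+ Y)
      ≡⟨ cancel (signed k (+ Y)) (signed k (+ X)) ⟩
    - signed k (+ X) ∎)
    where
    open ≡-Reasoning
    X = choose (n ℕ.+ suc k) (suc k)
    Y = choose (n ℕ.+ suc k) k
    cancel : ∀ a b → - (a + b) + a ≡ - b
    cancel = ℤ-Solver.solve-∀

-- Truncated Cauchy products:  conv a b k = Σ_{i+j=k} a i · b j,
-- over ℤ (where the algebra happens) and over ℕ (where the counting happens).
module Convolution where

  open import Data.Nat as ℕ using (ℕ; zero; suc)
  open import Data.Integer using (ℤ; +_; _+_; _*_)
  import Data.Integer.Properties as ℤP
  import Data.Integer.Tactic.RingSolver as ℤ-Solver
  open import Function using (_∘_)
  open import Relation.Binary.PropositionalEquality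

  conv : (ℕ → ℤ) → (ℕ → ℤ) → ℕ → ℤ
  conv a b zero = a 0 * b 0
  conv a b (suc k) = a 0 * b (suc k) + conv (a ∘ suc) b k

  convℕ : (ℕ → ℕ) → (ℕ → ℕ) → ℕ → ℕ
  convℕ a b zero = a 0 ℕ.* b 0
  convℕ a b (suc k) = a 0 ℕ.* b (suc k) ℕ.+ convℕ (a ∘ suc) b k

  convℕ-to-ℤ : ∀ a b k → + convℕ a b k ≡ conv (λ i → + a i) (λ i → + b i) k
  convℕ-to-ℤ a b zero = ℤP.pos-* (a 0) (b 0)
  convℕ-to-ℤ a b (suc k) =
    trans (ℤP.pos-+ (a 0 ℕ.* b (suc k)) (convℕ (a ∘ suc) b k))
          (cong₂ _+_ (ℤP.pos-* (a 0) (b (suc k))) (convℕ-to-ℤ (a ∘ suc) b k))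

  conv-cong : ∀ a b a' b' k → (∀ i j → i ℕ.+ j ≡ k → a i * b j ≡ a' i * b' j) →
              conv a b k ≡ conv a' b' k
  conv-cong a b a' b' zero h = h 0 0 refl
  conv-cong a b a' b' (suc k) h =
    cong₂ _+_ (h 0 (suc k) refl)
              (conv-cong (a ∘ suc) b (a' ∘ suc) b' k (λ i j e → h (suc i) j (cong suc e)))

  conv-unit : ∀ a b k → b 0 ≡ + 1 → (∀ j → b (suc j) ≡ + 0) → conv a b k ≡ a k
  conv-unit a b zero e0 eS = trans (cong (a 0 *_) e0) (ℤP.*-identityʳ (a 0))
  conv-unit a b (suc k) e0 eS =
    trans (cong₂ _+_ (trans (cong (a 0 *_) (eS k)) (ℤP.*-zeroʳ (a 0))) (conv-unit (a ∘ suc) b k e0 eS))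
          (ℤP.+-identityˡ _)

  -- If b' = b + x·c as power series, then a ⋆ b' = a ⋆ b + x·(a ⋆ c).
  conv-split : ∀ a b b' c k → b' 0 ≡ b 0 → (∀ j → b' (suc j) ≡ b (suc j) + c j) →
               conv a b' (suc k) ≡ conv a b (suc k) + conv a c k
  conv-split a b b' c zero e0 eS =
    trans (cong₂ _+_ (cong (a 0 *_) (eS 0)) (cong (a 1 *_) e0)) (regroup (a 0) (b 1) (c 0) (a 1 * b 0))
    where
    regroup : ∀ a0 b1 c0 a1b0 → a0 * (b1 + c0) + a1b0 ≡ (a0 * b1 + a1b0) + a0 * c0
    regroup = ℤ-Solver.solve-∀
  conv-split a b b' c (suc k) e0 eS =
    trans (cong₂ _+_ (cong (a 0 *_) (eS (suc k))) (conv-split (a ∘ suc) b b' c k e0 eS))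
          (regroup (a 0) (b (suc (suc k))) (c (suc k)) (conv (a ∘ suc) b (suc k)) (conv (a ∘ suc) c k))
    where
    regroup : ∀ a0 bk ck X Y → a0 * (bk + ck) + (X + Y) ≡ (a0 * bk + X) + (a0 * ck + Y)
    regroup = ℤ-Solver.solve-∀

  -- peeling off the last term; gives commutativity, needed when the marked
  -- point is not on the first circle
  conv-last : ∀ a b k → conv a b (suc k) ≡ conv a (b ∘ suc) k + a (suc k) * b 0
  conv-last a b zero = refl
  conv-last a b (suc k) =
    trans (cong (_+_ (a 0 * b (suc (suc k)))) (conv-last (a ∘ suc) b k))
          (sym (ℤP.+-assoc (a 0 * b (suc (suc k))) _ _))

  conv-comm : ∀ a b k → conv a b k ≡ conv b a k
  conv-comm a b zero = ℤP.*-comm (a 0) (b 0)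
  conv-comm a b (suc k) = begin
    a 0 * b (suc k) + conv (a ∘ suc) b k   ≡⟨ cong (_+_ (a 0 * b (suc k))) (conv-comm (a ∘ suc) b k) ⟩
    a 0 * b (suc k) + conv b (a ∘ suc) k   ≡⟨ ℤP.+-comm (a 0 * b (suc k)) _ ⟩
    conv b (a ∘ suc) k + a 0 * b (suc k)   ≡⟨ cong (_+_ (conv b (a ∘ suc) k)) (ℤP.*-comm (a 0) (b (suc k))) ⟩
    conv b (a ∘ suc) k + b (suc k) * a 0   ≡⟨ conv-last b a k ⟨
    conv b a (suc k)                       ∎
    where open ≡-Reasoning

-- For k ≥ 1 put
--   F y k = C(y - sk, k) + s·C(y - sk - 1, k - 1),     G y k = C(y - sk - 1, k - 1),
-- and F y 0 = 1, G y 0 = 0.  On a cycle of N ≥ sk + 1 points, F N k counts the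
-- s-separated k-subsets and G N k those containing a given point.  The main
-- results are the Vandermonde-type identities  F n ⋆ F N = F (n + N)  and
-- G n ⋆ F N = G (n + N), proved by induction on N over ℤ: both sides obey the
-- recurrence  K (y+1) (k+1) = K y (k+1) + K (y-s) k,  and agree at y = 0.
module CycleSeries (s : ℕ) where

  open import Data.Nat as ℕ using (ℕ; zero; suc; s≤s; z≤n)
  import Data.Nat.Properties as ℕP
  import Data.Nat.Tactic.RingSolver as ℕ-Solver
  open import Data.Integer using (ℤ; +_; -[1+_]; _+_; _*_; -_)
  import Data.Integer.Properties as ℤP
  import Data.Integer.Tactic.RingSolver as ℤ-Solver
  open import Algebra.Properties.AbelianGroup ℤP.+-0-abelianGroup using (∙-cancelʳ)
  open import Relation.Binary.PropositionalEquality
  open Binomial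
  open IntegerBinomial
  open Convolution

  F : ℤ → ℕ → ℤ
  F y zero = + 1
  F y (suc m) = zchoose (y -ⁿ s ℕ.* suc m) (suc m) + + s * zchoose (predℤ (y -ⁿ s ℕ.* suc m)) m

  G : ℤ → ℕ → ℤ
  G y zero = + 0
  G y (suc m) = zchoose (predℤ (y -ⁿ s ℕ.* suc m)) m

  -ⁿ-step : ∀ y m → (y -ⁿ s) -ⁿ s ℕ.* suc m ≡ y -ⁿ s ℕ.* suc (suc m)
  -ⁿ-step y m = trans (-ⁿ-+ y s (s ℕ.* suc m)) (cong (y -ⁿ_) (sym (unfold s m)))
    where
    unfold : ∀ s m → s ℕ.* suc (suc m) ≡ s ℕ.* suc m ℕ.+ s
    unfold = ℕ-Solver.solve-∀

  -- The cycle recurrence, from Pascal's rule for the two binomials in F and G.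
  F-recurrence : ∀ y m → F (sucℤ y) (suc m) ≡ F y (suc m) + F (y -ⁿ s) m
  F-recurrence y zero = begin
    zchoose (sucℤ y -ⁿ s ℕ.* 1) 1 + + s * zchoose (predℤ (sucℤ y -ⁿ s ℕ.* 1)) 0
      ≡⟨ cong (λ t → zchoose t 1 + + s * zchoose (predℤ t) 0) (sucℤ--ⁿ y (s ℕ.* 1)) ⟩
    zchoose (sucℤ z) 1 + + s * zchoose (predℤ (sucℤ z)) 0
      ≡⟨ cong₂ (λ u v → u + + s * v) (zchoose-pascal z 0) (zchoose-0 (predℤ (sucℤ z))) ⟩
    (zchoose z 1 + zchoose z 0) + + s * + 1
      ≡⟨ cong (λ u → (zchoose z 1 + u) + + s * + 1) (zchoose-0 z) ⟩
    (zchoose z 1 + + 1) + + s * + 1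
      ≡⟨ regroup (zchoose z 1) (+ s) ⟩
    (zchoose z 1 + + s * + 1) + + 1
      ≡⟨ cong (λ v → (zchoose z 1 + + s * v) + + 1) (zchoose-0 (predℤ z)) ⟨
    (zchoose z 1 + + s * zchoose (predℤ z) 0) + + 1 ∎
    where
    open ≡-Reasoning
    z = y -ⁿ s ℕ.* 1
    regroup : ∀ a c → (a + + 1) + c * + 1 ≡ (a + c * + 1) + + 1
    regroup = ℤ-Solver.solve-∀
  F-recurrence y (suc m) = begin
    F (sucℤ y) (suc (suc m))
      ≡⟨ cong (λ t → zchoose t (suc (suc m)) + + s * zchoose (predℤ t) (suc m)) (sucℤ--ⁿ y (s ℕ.* suc (suc m))) ⟩
    zchoose (sucℤ z) (suc (suc m)) + + s * zchoose (predℤ (sucℤ z)) (suc m)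
      ≡⟨ cong₂ (λ u v → u + + s * zchoose v (suc m)) (zchoose-pascal z (suc m)) (predℤ-sucℤ z) ⟩
    (zchoose z (suc (suc m)) + zchoose z (suc m)) + + s * zchoose z (suc m)
      ≡⟨ cong (λ t → (zchoose z (suc (suc m)) + zchoose z (suc m)) + + s * t) z-pascal ⟩
    (zchoose z (suc (suc m)) + zchoose z (suc m)) + + s * (zchoose pz (suc m) + zchoose pz m)
      ≡⟨ regroup (zchoose z (suc (suc m))) (zchoose z (suc m)) (+ s) (zchoose pz (suc m)) (zchoose pz m) ⟩
    F y (suc (suc m)) + (zchoose z (suc m) + + s * zchoose pz m)
      ≡⟨ cong (_+_ (F y (suc (suc m)))) (cong (λ t → zchoose t (suc m) + + s * zchoose (predℤ t) m) (-ⁿ-step y m)) ⟨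
    F y (suc (suc m)) + F (y -ⁿ s) (suc m) ∎
    where
    open ≡-Reasoning
    z = y -ⁿ s ℕ.* suc (suc m)
    pz = predℤ z
    z-pascal : zchoose z (suc m) ≡ zchoose pz (suc m) + zchoose pz m
    z-pascal = trans (cong (λ t → zchoose t (suc m)) (sym (sucℤ-predℤ z))) (zchoose-pascal pz m)
    regroup : ∀ A c S p q → (A + c) + S * (p + q) ≡ (A + S * p) + (c + S * q)
    regroup = ℤ-Solver.solve-∀

  -- G satisfies the same recurrence (Pascals rule once).
  G-recurrence : ∀ y m → G (sucℤ y) (suc m) ≡ G y (suc m) + G (y -ⁿ s) m
  G-recurrence y zero =
    trans (zchoose-0 (predℤ (sucℤ y -ⁿ s ℕ.* 1)))
          (sym (trans (ℤP.+-identityʳ _) (zchoose-0 (predℤ (y -ⁿ s ℕ.* 1)))))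
  G-recurrence y (suc m) = begin
    zchoose (predℤ (sucℤ y -ⁿ s ℕ.* suc (suc m))) (suc m)
      ≡⟨ cong (λ t → zchoose (predℤ t) (suc m)) (sucℤ--ⁿ y (s ℕ.* suc (suc m))) ⟩
    zchoose (predℤ (sucℤ u)) (suc m)
      ≡⟨ cong (λ t → zchoose t (suc m)) (trans (predℤ-sucℤ u) (sym (sucℤ-predℤ u))) ⟩
    zchoose (sucℤ (predℤ u)) (suc m)
      ≡⟨ zchoose-pascal (predℤ u) m ⟩
    zchoose (predℤ u) (suc m) + zchoose (predℤ u) m
      ≡⟨ cong (λ t → zchoose (predℤ u) (suc m) + zchoose (predℤ t) m) (-ⁿ-step y m) ⟨
    G y (suc (suc m)) + G (y -ⁿ s) (suc m) ∎
    where
    open ≡-Reasoning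
    u = y -ⁿ s ℕ.* suc (suc m)

  -- F 0 k = 0 for k ≥ 1 (this needs s ≥ 1): then C(-sk, k) = -s·C(-sk-1, k-1).
  F-vanishes-at-0 : 1 ℕ.≤ s → ∀ m → F (+ 0) (suc m) ≡ + 0
  F-vanishes-at-0 (s≤s z≤n) m = vanish (m ℕ.+ ℕ.pred s ℕ.* suc m) refl
    where
    vanish : ∀ j → s ℕ.* suc m ≡ suc j → F (+ 0) (suc m) ≡ + 0
    vanish j e = begin
      F (+ 0) (suc m)
        ≡⟨ cong (λ t → zchoose t (suc m) + + s * zchoose (predℤ t) m) (trans (cong (+ 0 -ⁿ_) e) (0-ⁿ j)) ⟩
      - signed m (+ choose (j ℕ.+ suc m) (suc m)) + + s * signed m (+ Y)
        ≡⟨ cong (λ t → - signed m (+ t) + + s * signed m (+ Y)) (trans (cong (λ t → choose t (suc m)) (ℕP.+-suc j m)) X≡sY) ⟩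
      - signed m (+ (s ℕ.* Y)) + + s * signed m (+ Y)
        ≡⟨ cong (λ t → - t + + s * signed m (+ Y)) (trans (cong (signed m) (ℤP.pos-* s Y)) (signed-* m (+ s) (+ Y))) ⟩
      - (+ s * signed m (+ Y)) + + s * signed m (+ Y)
        ≡⟨ ℤP.+-inverseˡ (+ s * signed m (+ Y)) ⟩
      + 0 ∎
      where
      open ≡-Reasoning
      N = suc j ℕ.+ m
      X = choose N (suc m)
      Y = choose N m
      -- from (m+1)·C(N,m+1) + (m+1)·C(N,m) = (N+1)·C(N,m) and N+1 = s(m+1) + (m+1)
      X≡sY : X ≡ s ℕ.* Y
      X≡sY = ℕP.*-cancelˡ-≡ X (s ℕ.* Y) (suc m) (ℕP.+-cancelʳ-≡ _ _ _ (begin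
        suc m ℕ.* X ℕ.+ suc m ℕ.* Y          ≡⟨ choose-ratio N m ⟩
        suc N ℕ.* Y                          ≡⟨ cong (ℕ._* Y) (trans (sym (ℕP.+-suc (suc j) m)) (cong (ℕ._+ suc m) (sym e))) ⟩
        (s ℕ.* suc m ℕ.+ suc m) ℕ.* Y        ≡⟨ regroup s m Y ⟩
        suc m ℕ.* (s ℕ.* Y) ℕ.+ suc m ℕ.* Y  ∎))
        where
        regroup : ∀ s m Y → (s ℕ.* suc m ℕ.+ suc m) ℕ.* Y ≡ suc m ℕ.* (s ℕ.* Y) ℕ.+ suc m ℕ.* Y
        regroup = ℕ-Solver.solve-∀

  ℤ-induction : (P : ℤ → Set) → P (+ 0) → (∀ z → P z → P (sucℤ z)) → (∀ z → P (sucℤ z) → P z) →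
                ∀ z → P z
  ℤ-induction P p0 up down (+ zero) = p0
  ℤ-induction P p0 up down (+ suc n) = up (+ n) (ℤ-induction P p0 up down (+ n))
  ℤ-induction P p0 up down -[1+ zero ] = down -[1+ 0 ] p0
  ℤ-induction P p0 up down -[1+ suc n ] = down -[1+ suc n ] (ℤ-induction P p0 up down -[1+ n ])

  module Expansion (s≥1 : 1 ℕ.≤ s) (K : ℤ → ℕ → ℤ)
                   (K-0 : ∀ y → K y 0 ≡ K (+ 0) 0)
                   (K-recurrence : ∀ z m → K (sucℤ z) (suc m) ≡ K z (suc m) + K (z -ⁿ s) m) where

    expansion : ∀ k y → conv (K (+ 0)) (F y) k ≡ K y k
    expansion zero y = trans (ℤP.*-identityʳ _) (sym (K-0 y))
    expansion (suc k) = ℤ-induction P base up down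
      where
      P : ℤ → Set
      P y = conv (K (+ 0)) (F y) (suc k) ≡ K y (suc k)
      base : P (+ 0)
      base = conv-unit (K (+ 0)) (F (+ 0)) (suc k) refl (F-vanishes-at-0 s≥1)
      -- both sides grow by K (y - s) k when y increases by one
      step : ∀ y → conv (K (+ 0)) (F (sucℤ y)) (suc k) ≡ conv (K (+ 0)) (F y) (suc k) + K (y -ⁿ s) k
      step y = trans (conv-split (K (+ 0)) (F y) (F (sucℤ y)) (F (y -ⁿ s)) k refl (F-recurrence y))
                     (cong (_+_ (conv (K (+ 0)) (F y) (suc k))) (expansion k (y -ⁿ s)))
      up : ∀ y → P y → P (sucℤ y)
      up y p = trans (step y) (trans (cong (_+ K (y -ⁿ s) k) p) (sym (K-recurrence y k)))
      down : ∀ y → P (sucℤ y) → P y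
      down y p = ∙-cancelʳ (K (y -ⁿ s) k) _ _ (trans (sym (step y)) (trans p (K-recurrence y k)))

  -- Shifting the argument of a family preserves the cycle recurrence, so
  -- K (n + y) = K n ⋆ F y for K ∈ {F, G}.
  module _ (s≥1 : 1 ℕ.≤ s) (K : ℤ → ℕ → ℤ) (K-0 : ∀ y z → K y 0 ≡ K z 0)
           (K-recurrence : ∀ z m → K (sucℤ z) (suc m) ≡ K z (suc m) + K (z -ⁿ s) m) where

    shifted-expansion : ∀ n N k → conv (K (+ n)) (F (+ N)) k ≡ K (+ (n ℕ.+ N)) k
    shifted-expansion n N k =
      trans (conv-cong _ _ _ _ k (λ i j _ → cong (λ t → K t i * F (+ N) j) (sym n+ⁿ0)))
            (trans (expansion k (+ N)) (cong (λ t → K t k) (+ⁿ-pos n N)))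
      where
      n+ⁿ0 : n +ⁿ + 0 ≡ + n
      n+ⁿ0 = trans (+ⁿ-pos n 0) (cong +_ (ℕP.+-identityʳ n))
      shifted-recurrence : ∀ z m → K (n +ⁿ sucℤ z) (suc m) ≡ K (n +ⁿ z) (suc m) + K (n +ⁿ (z -ⁿ s)) m
      shifted-recurrence z m =
        trans (cong (λ t → K t (suc m)) (+ⁿ-sucℤ n z))
              (trans (K-recurrence (n +ⁿ z) m) (cong (λ t → K (n +ⁿ z) (suc m) + K t m) (sym (+ⁿ--ⁿ n z s))))
      open Expansion s≥1 (λ z → K (n +ⁿ z)) (λ y → K-0 _ _) shifted-recurrence

  -- Vandermonde laws: counts on two cycles combine like one long cycle.
  F-vandermonde : 1 ℕ.≤ s → ∀ n N k → conv (F (+ n)) (F (+ N)) k ≡ F (+ (n ℕ.+ N)) k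
  F-vandermonde s≥1 = shifted-expansion s≥1 F (λ _ _ → refl) F-recurrence

  G-vandermonde : 1 ℕ.≤ s → ∀ n N k → conv (G (+ n)) (F (+ N)) k ≡ G (+ (n ℕ.+ N)) k
  G-vandermonde s≥1 = shifted-expansion s≥1 G (λ _ _ → refl) G-recurrence

module Sums where

  open import Defs using (filter; allSubsets; allFamilies; Family; consF)
  open import Data.Bool using (Bool; true; false)
  open import Data.Nat using (ℕ; zero; suc; _+_; _*_)
  open import Data.Nat.Properties using (+-identityʳ; *-distribˡ-+)
  open import Data.Nat.ListAction using (sum)
  open import Data.Nat.ListAction.Properties using (sum-++)
  import Data.Nat.Tactic.RingSolver as ℕ-Solver
  open import Data.Fin using (Fin; zero; suc)
  open import Data.Vec using (Vec; []; _∷_)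
  open import Data.List using (List; []; _∷_; map; concatMap; length)
  open import Data.List.Properties using (map-++; map-cong; map-∘)
  open import Function using (_∘_)
  open import Relation.Binary.PropositionalEquality

  𝟙 : Bool → ℕ
  𝟙 true = 1
  𝟙 false = 0

  length-filter : ∀ {A : Set} (P : A → Bool) xs → length (filter P xs) ≡ sum (map (𝟙 ∘ P) xs)
  length-filter P [] = refl
  length-filter P (x ∷ xs) with P x
  ... | true = cong suc (length-filter P xs)
  ... | false = length-filter P xs

  sum-map-cong : ∀ {A : Set} (h h' : A → ℕ) xs → (∀ x → h x ≡ h' x) → sum (map h xs) ≡ sum (map h' xs)
  sum-map-cong h h' xs e = cong sum (map-cong e xs)

  sum-concatMap : ∀ {A B : Set} (h : B → ℕ) (f : A → List B) xs →
                  sum (map h (concatMap f xs)) ≡ sum (map (λ x → sum (map h (f x))) xs)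
  sum-concatMap h f [] = refl
  sum-concatMap h f (x ∷ xs) =
    trans (cong sum (map-++ h (f x) (concatMap f xs)))
          (trans (sum-++ (map h (f x)) (map h (concatMap f xs)))
                 (cong (sum (map h (f x)) +_) (sum-concatMap h f xs)))

  sumSubsets : (n : ℕ) → (Vec Bool n → ℕ) → ℕ
  sumSubsets zero h = h []
  sumSubsets (suc n) h = sumSubsets n (λ v → h (true ∷ v)) + sumSubsets n (λ v → h (false ∷ v))

  sumSubsets-cong : ∀ n h h' → (∀ v → h v ≡ h' v) → sumSubsets n h ≡ sumSubsets n h'
  sumSubsets-cong zero h h' e = e []
  sumSubsets-cong (suc n) h h' e =
    cong₂ _+_ (sumSubsets-cong n _ _ (e ∘ (true ∷_))) (sumSubsets-cong n _ _ (e ∘ (false ∷_)))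

  sumSubsets-+ : ∀ n h h' → sumSubsets n (λ v → h v + h' v) ≡ sumSubsets n h + sumSubsets n h'
  sumSubsets-+ zero h h' = refl
  sumSubsets-+ (suc n) h h' =
    trans (cong₂ _+_ (sumSubsets-+ n (h ∘ (true ∷_)) (h' ∘ (true ∷_))) (sumSubsets-+ n (h ∘ (false ∷_)) (h' ∘ (false ∷_))))
          (swap-middle (sumSubsets n (h ∘ (true ∷_))) (sumSubsets n (h' ∘ (true ∷_)))
                       (sumSubsets n (h ∘ (false ∷_))) (sumSubsets n (h' ∘ (false ∷_))))
    where
    swap-middle : ∀ a b c d → (a + b) + (c + d) ≡ (a + c) + (b + d)
    swap-middle = ℕ-Solver.solve-∀

  sumSubsets-* : ∀ n h c → sumSubsets n (λ v → c * h v) ≡ c * sumSubsets n h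
  sumSubsets-* zero h c = refl
  sumSubsets-* (suc n) h c =
    trans (cong₂ _+_ (sumSubsets-* n _ c) (sumSubsets-* n _ c)) (sym (*-distribˡ-+ c _ _))

  sumSubsets-0 : ∀ n → sumSubsets n (λ v → 0) ≡ 0
  sumSubsets-0 zero = refl
  sumSubsets-0 (suc n) = cong₂ _+_ (sumSubsets-0 n) (sumSubsets-0 n)

  sum-allSubsets : ∀ n h → sum (map h (allSubsets n)) ≡ sumSubsets n h
  sum-allSubsets zero h = +-identityʳ (h [])
  sum-allSubsets (suc n) h =
    trans (sum-concatMap h _ (allSubsets n))
     (trans (sum-map-cong _ (λ v → h (true ∷ v) + h (false ∷ v)) (allSubsets n)
                          (λ v → cong (h (true ∷ v) +_) (+-identityʳ _)))
      (trans (sum-map-+ (allSubsets n)) (cong₂ _+_ (sum-allSubsets n _) (sum-allSubsets n _))))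
    where
    sum-map-+ : ∀ xs → sum (map (λ v → h (true ∷ v) + h (false ∷ v)) xs)
                       ≡ sum (map (λ v → h (true ∷ v)) xs) + sum (map (λ v → h (false ∷ v)) xs)
    sum-map-+ [] = refl
    sum-map-+ (v ∷ xs) = trans (cong (h (true ∷ v) + h (false ∷ v) +_) (sum-map-+ xs))
                               (swap-middle (h (true ∷ v)) (h (false ∷ v)) _ _)
      where
      swap-middle : ∀ a b c d → (a + b) + (c + d) ≡ (a + c) + (b + d)
      swap-middle = ℕ-Solver.solve-∀

  sumFamilies : (p : ℕ) (n : Fin p → ℕ) → (Family p n → ℕ) → ℕ
  sumFamilies zero n h = h (λ ())
  sumFamilies (suc p) n h = sumSubsets (n zero) (λ v → sumFamilies p (n ∘ suc) (h ∘ consF v))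

  sumFamilies-cong : ∀ p n h h' → (∀ A → h A ≡ h' A) → sumFamilies p n h ≡ sumFamilies p n h'
  sumFamilies-cong zero n h h' e = e (λ ())
  sumFamilies-cong (suc p) n h h' e =
    sumSubsets-cong (n zero) _ _ (λ v → sumFamilies-cong p (n ∘ suc) _ _ (e ∘ consF v))

  sumFamilies-* : ∀ p n h c → sumFamilies p n (λ A → c * h A) ≡ c * sumFamilies p n h
  sumFamilies-* zero n h c = refl
  sumFamilies-* (suc p) n h c =
    trans (sumSubsets-cong (n zero) _ _ (λ v → sumFamilies-* p (n ∘ suc) _ c)) (sumSubsets-* (n zero) _ c)

  sum-allFamilies : ∀ p n h → sum (map h (allFamilies p n)) ≡ sumFamilies p n h
  sum-allFamilies zero n h = +-identityʳ _
  sum-allFamilies (suc p) n h =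
    trans (sum-concatMap h _ (allSubsets (n zero)))
     (trans (sum-map-cong _ _ (allSubsets (n zero))
               (λ v → trans (cong sum (sym (map-∘ (allFamilies p (n ∘ suc))))) (sum-allFamilies p (n ∘ suc) _)))
       (sum-allSubsets (n zero) _))

-- A subset of [n_1,...,n_p] is a subset v of the
-- first circle together with a subset R of the others; it is separated iff v
-- and R are, and its size is |v| + |R|.  Hence counts of subsets of size k
-- with a property that splits as X v ∧ Y R are convolutions of the counts for
-- X on the first circle and for Y on the remaining circles.
module Decomposition where

  open import Defs
  open import Data.Bool using (Bool; true; false; _∧_; not)
  open import Data.Nat using (ℕ; zero; suc; _+_; _*_; _∸_; _≤ᵇ_; _≡ᵇ_)
  open import Data.Nat.Properties using (*-assoc; *-distribˡ-+; *-comm; +-identityʳ)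
  import Data.Nat.Tactic.RingSolver as ℕ-Solver
  open import Data.Nat.ListAction using (sum)
  open import Data.Bool.ListAction using (and)
  open import Data.Fin using (Fin; zero; suc; toℕ)
  open import Data.Fin.Subset using (Subset; ∣_∣)
  open import Data.Vec using (Vec; lookup)
  open import Data.List using (_∷_; map; allFin)
  open import Data.List.Properties using (map-tabulate)
  open import Function using (_∘_)
  open import Relation.Binary.PropositionalEquality
  open ≡-Reasoning
  open Convolution using (convℕ)
  open Sums

  separatedCircle : ℕ → (m : ℕ) → Subset m → Bool
  separatedCircle s m v = all (λ x → all (λ y →
          ((lookup v x ∧ lookup v y) ∧ not (toℕ x ≡ᵇ toℕ y))
            ⇒ᵇ farApart s m (toℕ x) (toℕ y))
        (allFin m)) (allFin m)

  map-allFin : ∀ {X : Set} p (f : Fin (suc p) → X) → map f (allFin (suc p)) ≡ f zero ∷ map (f ∘ suc) (allFin p)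
  map-allFin p f = cong (f zero ∷_) (trans (map-tabulate suc f) (sym (map-tabulate (λ i → i) (f ∘ suc))))

  separated-consF : ∀ s p (n : Fin (suc p) → ℕ) v (R : Family p (n ∘ suc)) →
                    separated s (consF {p} {n} v R) ≡ separatedCircle s (n zero) v ∧ separated s R
  separated-consF s p n v R = cong and (map-allFin p _)

  card-consF : ∀ p (n : Fin (suc p) → ℕ) v (R : Family p (n ∘ suc)) → card (consF {p} {n} v R) ≡ ∣ v ∣ + card R
  card-consF p n v R = cong sum (map-allFin p _)

  countSubsets : (m : ℕ) → (Subset m → Bool) → ℕ → ℕ
  countSubsets m X i = sumSubsets m (λ v → 𝟙 (X v) * 𝟙 (∣ v ∣ ≡ᵇ i))

  countFamilies : (p : ℕ) (n : Fin p → ℕ) → (Family p n → Bool) → ℕ → ℕ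
  countFamilies p n P k = sumFamilies p n (λ A → 𝟙 (P A) * 𝟙 (card A ≡ᵇ k))

  𝟙-∧ : ∀ a b → 𝟙 (a ∧ b) ≡ 𝟙 a * 𝟙 b
  𝟙-∧ true b = sym (+-identityʳ (𝟙 b))
  𝟙-∧ false b = refl

  ≤ᵇ-suc : ∀ d m → (suc d ≤ᵇ suc m) ≡ (d ≤ᵇ m)
  ≤ᵇ-suc zero m = refl
  ≤ᵇ-suc (suc d) m = refl

  ≡ᵇ-+ : ∀ d e k → (d + e ≡ᵇ k) ≡ ((d ≤ᵇ k) ∧ (e ≡ᵇ k ∸ d))
  ≡ᵇ-+ zero e k = refl
  ≡ᵇ-+ (suc d) e zero = refl
  ≡ᵇ-+ (suc d) e (suc k) = trans (≡ᵇ-+ d e k) (cong (_∧ (e ≡ᵇ k ∸ d)) (sym (≤ᵇ-suc d k)))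

  convℕ-shift : ∀ d b k → 𝟙 (d ≤ᵇ k) * b (k ∸ d) ≡ convℕ (λ i → 𝟙 (d ≡ᵇ i)) b k
  convℕ-shift zero b zero = refl
  convℕ-shift (suc d) b zero = refl
  convℕ-shift zero b (suc k) = sym (trans (cong (b (suc k) + 0 +_) (zeros k)) (+-identityʳ _))
    where
    zeros : ∀ k → convℕ (λ i → 0) b k ≡ 0
    zeros zero = refl
    zeros (suc k) = zeros k
  convℕ-shift (suc d) b (suc k) = trans (cong (λ t → 𝟙 t * b (k ∸ d)) (≤ᵇ-suc d k)) (convℕ-shift d b k)

  convℕ-scale : ∀ c a b k → c * convℕ a b k ≡ convℕ (λ i → c * a i) b k
  convℕ-scale c a b zero = sym (*-assoc c (a 0) (b 0))
  convℕ-scale c a b (suc k) =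
    trans (*-distribˡ-+ c _ _) (cong₂ _+_ (sym (*-assoc c (a 0) (b (suc k)))) (convℕ-scale c (a ∘ suc) b k))

  sumSubsets-convℕ : ∀ n (a : Vec Bool n → ℕ → ℕ) b k →
    sumSubsets n (λ v → convℕ (a v) b k) ≡ convℕ (λ i → sumSubsets n (λ v → a v i)) b k
  sumSubsets-convℕ n a b zero = scale-right n a b 0
    where
    scale-right : ∀ n (a : Vec Bool n → ℕ → ℕ) b i →
                  sumSubsets n (λ v → a v i * b i) ≡ sumSubsets n (λ v → a v i) * b i
    scale-right n a b i =
      trans (sumSubsets-cong n _ _ (λ v → *-comm (a v i) (b i)))
            (trans (sumSubsets-* n (λ v → a v i) (b i)) (*-comm (b i) _))
  sumSubsets-convℕ n a b (suc k) =
    trans (sumSubsets-+ n (λ v → a v 0 * b (suc k)) (λ v → convℕ (a v ∘ suc) b k))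
          (cong₂ _+_ (trans (sumSubsets-cong n _ _ (λ v → *-comm (a v 0) (b (suc k))))
                            (trans (sumSubsets-* n (λ v → a v 0) (b (suc k))) (*-comm (b (suc k)) _)))
                     (sumSubsets-convℕ n (λ v i → a v (suc i)) b k))

  countFamilies-consF :
    ∀ p (n : Fin (suc p) → ℕ) (P : Family (suc p) n → Bool)
      (X : Subset (n zero) → Bool) (Y : Family p (n ∘ suc) → Bool) →
    (∀ v R → P (consF v R) ≡ X v ∧ Y R) →
    ∀ k → countFamilies (suc p) n P k ≡ convℕ (countSubsets (n zero) X) (countFamilies p (n ∘ suc) Y) k
  countFamilies-consF p n P X Y split k = begin
    sumSubsets (n zero) (λ v → sumFamilies p (n ∘ suc) (λ R → 𝟙 (P (consF {p} {n} v R)) * 𝟙 (card (consF {p} {n} v R) ≡ᵇ k)))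
      ≡⟨ sumSubsets-cong (n zero) _ _ per-v ⟩
    sumSubsets (n zero) (λ v → 𝟙 (X v) * convℕ (λ i → 𝟙 (∣ v ∣ ≡ᵇ i)) c k)
      ≡⟨ sumSubsets-cong (n zero) _ _ (λ v → convℕ-scale (𝟙 (X v)) _ c k) ⟩
    sumSubsets (n zero) (λ v → convℕ (λ i → 𝟙 (X v) * 𝟙 (∣ v ∣ ≡ᵇ i)) c k)
      ≡⟨ sumSubsets-convℕ (n zero) (λ v i → 𝟙 (X v) * 𝟙 (∣ v ∣ ≡ᵇ i)) c k ⟩
    convℕ (countSubsets (n zero) X) c k ∎
    where
    c = countFamilies p (n ∘ suc) Y
    regroup : ∀ x y a b → (x * y) * (a * b) ≡ x * (a * (y * b))
    regroup = ℕ-Solver.solve-∀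
    summand : ∀ v R → 𝟙 (P (consF {p} {n} v R)) * 𝟙 (card (consF {p} {n} v R) ≡ᵇ k)
                      ≡ 𝟙 (X v) * (𝟙 (∣ v ∣ ≤ᵇ k) * (𝟙 (Y R) * 𝟙 (card R ≡ᵇ k ∸ ∣ v ∣)))
    summand v R = begin
      𝟙 (P (consF {p} {n} v R)) * 𝟙 (card (consF {p} {n} v R) ≡ᵇ k)
        ≡⟨ cong₂ (λ x y → 𝟙 x * 𝟙 (y ≡ᵇ k)) (split v R) (card-consF p n v R) ⟩
      𝟙 (X v ∧ Y R) * 𝟙 (∣ v ∣ + card R ≡ᵇ k)
        ≡⟨ cong₂ _*_ (𝟙-∧ (X v) (Y R)) (trans (cong 𝟙 (≡ᵇ-+ ∣ v ∣ (card R) k)) (𝟙-∧ (∣ v ∣ ≤ᵇ k) (card R ≡ᵇ k ∸ ∣ v ∣))) ⟩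
      (𝟙 (X v) * 𝟙 (Y R)) * (𝟙 (∣ v ∣ ≤ᵇ k) * 𝟙 (card R ≡ᵇ k ∸ ∣ v ∣))
        ≡⟨ regroup (𝟙 (X v)) (𝟙 (Y R)) (𝟙 (∣ v ∣ ≤ᵇ k)) _ ⟩
      𝟙 (X v) * (𝟙 (∣ v ∣ ≤ᵇ k) * (𝟙 (Y R) * 𝟙 (card R ≡ᵇ k ∸ ∣ v ∣))) ∎
    per-v : ∀ v → sumFamilies p (n ∘ suc) (λ R → 𝟙 (P (consF {p} {n} v R)) * 𝟙 (card (consF {p} {n} v R) ≡ᵇ k))
                  ≡ 𝟙 (X v) * convℕ (λ i → 𝟙 (∣ v ∣ ≡ᵇ i)) c k
    per-v v =
      trans (sumFamilies-cong p (n ∘ suc) _ _ (summand v))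
       (trans (sumFamilies-* p (n ∘ suc) _ (𝟙 (X v)))
        (cong (𝟙 (X v) *_) (trans (sumFamilies-* p (n ∘ suc) _ (𝟙 (∣ v ∣ ≤ᵇ k))) (convℕ-shift ∣ v ∣ c k))))

module CircleSeparation where

  open import Defs using (all; _⇒ᵇ_)
  open import Data.Bool using (Bool; true; false; _∧_; not)
  open import Data.Nat using (ℕ; zero; suc; _+_; _≤ᵇ_; _≡ᵇ_; _≤_; ∣_-_∣)
  open import Data.Nat.Properties using (≤ᵇ⇒≤; ≤⇒≤ᵇ; +-comm; +-cancelʳ-≤; +-monoˡ-≤)
  open import Data.Bool.Properties using (T-≡)
  open import Data.Empty using (⊥-elim)
  open import Data.Fin using (Fin; zero; suc; toℕ)
  open import Data.Vec using (Vec; lookup)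
  open import Data.List using (tabulate)
  open import Function using (_∘_; Equivalence)
  open import Relation.Nullary using (¬_)
  open import Relation.Binary.PropositionalEquality
  open Decomposition using (separatedCircle)

  ≤ᵇ-sound : ∀ m n → (m ≤ᵇ n) ≡ true → m ≤ n
  ≤ᵇ-sound m n e = ≤ᵇ⇒≤ m n (Equivalence.from T-≡ e)

  ≤ᵇ-complete : ∀ {m n} → m ≤ n → (m ≤ᵇ n) ≡ true
  ≤ᵇ-complete le = Equivalence.to T-≡ (≤⇒≤ᵇ le)

  ∧-left : ∀ {a b} → (a ∧ b) ≡ true → a ≡ true
  ∧-left {true} e = refl

  ∧-right : ∀ {a b} → (a ∧ b) ≡ true → b ≡ true
  ∧-right {true} e = e

  ∧-intro : ∀ {a b} → a ≡ true → b ≡ true → (a ∧ b) ≡ true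
  ∧-intro refl refl = refl

  ⇒ᵇ-elim : ∀ {a b} → (a ⇒ᵇ b) ≡ true → a ≡ true → b ≡ true
  ⇒ᵇ-elim {true} e _ = e

  ⇒ᵇ-intro : ∀ {a b} → (a ≡ true → b ≡ true) → (a ⇒ᵇ b) ≡ true
  ⇒ᵇ-intro {true} h = h refl
  ⇒ᵇ-intro {false} h = refl

  bool-ext : ∀ {a b} → (a ≡ true → b ≡ true) → (b ≡ true → a ≡ true) → a ≡ b
  bool-ext {true} {true} f g = refl
  bool-ext {true} {false} f g = sym (f refl)
  bool-ext {false} {true} f g = g refl
  bool-ext {false} {false} f g = refl

  all-elim : ∀ {X : Set} m (f : Fin m → X) (P : X → Bool) → all P (tabulate f) ≡ true → ∀ i → P (f i) ≡ true
  all-elim (suc m) f P e zero = ∧-left e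
  all-elim (suc m) f P e (suc i) = all-elim m (f ∘ suc) P (∧-right {P (f zero)} e) i

  all-intro : ∀ {X : Set} m (f : Fin m → X) (P : X → Bool) → (∀ i → P (f i) ≡ true) → all P (tabulate f) ≡ true
  all-intro zero f P h = refl
  all-intro (suc m) f P h = ∧-intro (h zero) (all-intro m (f ∘ suc) P (h ∘ suc))

  ≢-sound : ∀ a b → not (a ≡ᵇ b) ≡ true → ¬ a ≡ b
  ≢-sound zero zero () e
  ≢-sound (suc a) (suc b) h refl = ≢-sound a b h refl

  ≢-complete : ∀ a b → ¬ a ≡ b → not (a ≡ᵇ b) ≡ true
  ≢-complete zero zero ne = ⊥-elim (ne refl)
  ≢-complete zero (suc b) ne = refl
  ≢-complete (suc a) zero ne = refl
  ≢-complete (suc a) (suc b) ne = ≢-complete a b (ne ∘ cong suc)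

  gapOK : ℕ → ℕ → ℕ → Bool
  gapOK s m d = (suc s ≤ᵇ d) ∧ (suc s + d ≤ᵇ m)

  -- The condition is symmetric under d ↦ m - d (going around the other way).
  gapOK-complement : ∀ s m d e → d + e ≡ m → gapOK s m d ≡ gapOK s m e
  gapOK-complement s m d e d+e = bool-ext (one-way d e d+e) (one-way e d (trans (+-comm e d) d+e))
    where
    one-way : ∀ d e → d + e ≡ m → gapOK s m d ≡ true → gapOK s m e ≡ true
    one-way d e d+e h = ∧-intro (≤ᵇ-complete s<e) (≤ᵇ-complete s+e<m)
      where
      s<d = ≤ᵇ-sound (suc s) d (∧-left h)
      s+d<m = ≤ᵇ-sound (suc s + d) m (∧-right {suc s ≤ᵇ d} h)
      s<e : suc s ≤ e
      s<e = +-cancelʳ-≤ d (suc s) e (subst (suc s + d ≤_) (trans (sym d+e) (+-comm d e)) s+d<m)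
      s+e<m : suc s + e ≤ m
      s+e<m = subst (suc s + e ≤_) d+e (+-monoˡ-≤ e s<d)

  Separated : ℕ → (m : ℕ) → Vec Bool m → Set
  Separated s m v = ∀ x y → lookup v x ≡ true → lookup v y ≡ true → ¬ toℕ x ≡ toℕ y →
                    gapOK s m ∣ toℕ x - toℕ y ∣ ≡ true

  separated-sound : ∀ s m v → separatedCircle s m v ≡ true → Separated s m v
  separated-sound s m v e x y vx vy ne =
    ⇒ᵇ-elim (all-elim m (λ i → i) _ (all-elim m (λ i → i) _ e x) y)
            (∧-intro (∧-intro vx vy) (≢-complete (toℕ x) (toℕ y) ne))

  separated-complete : ∀ s m v → Separated s m v → separatedCircle s m v ≡ true
  separated-complete s m v h =
    all-intro m (λ i → i) _ (λ x → all-intro m (λ i → i) _ (λ y → ⇒ᵇ-intro (λ c →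
      h x y (∧-left (∧-left c)) (∧-right (∧-left {lookup v x ∧ lookup v y} c))
            (≢-sound (toℕ x) (toℕ y) (∧-right {lookup v x ∧ lookup v y} c)))))

  separated-ext : ∀ s m v w → (Separated s m v → Separated s m w) → (Separated s m w → Separated s m v) →
                  separatedCircle s m v ≡ separatedCircle s m w
  separated-ext s m v w f g =
    bool-ext (λ e → separated-complete s m w (f (separated-sound s m v e)))
             (λ e → separated-complete s m v (g (separated-sound s m w e)))

module Rotation where

  open import Data.Bool using (Bool; true; false)
  open import Data.Nat using (zero; suc; _+_; _∸_; ∣_-_∣)
  import Data.Nat.Properties as ℕP
  import Data.Nat.Tactic.RingSolver as ℕ-Solver
  open import Data.Empty using (⊥-elim)
  open import Data.Fin using (Fin; zero; suc; toℕ; inject₁; fromℕ)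
  open import Data.Fin.Properties using (toℕ-inject₁; toℕ-fromℕ; toℕ<n)
  open import Data.Fin.Subset using (∣_∣)
  open import Data.Vec using (Vec; []; _∷_; lookup; _∷ʳ_)
  open import Data.Product using (Σ; _,_; _×_)
  open import Data.Sum using (_⊎_; inj₁; inj₂)
  open import Relation.Binary.PropositionalEquality
  open Sums using (sumSubsets)
  open Decomposition using (separatedCircle)
  open CircleSeparation

  rotate : ∀ {L} → Vec Bool (suc L) → Vec Bool (suc L)
  rotate (b ∷ w) = w ∷ʳ b

  -- Next x x' : x' = x + 1 (mod L + 1); position x of rotate v is position x' of v.
  Next : ∀ {L} → Fin (suc L) → Fin (suc L) → Set
  Next {L} x x' = (Σ (Fin L) λ i → (x ≡ inject₁ i) × (x' ≡ suc i)) ⊎ ((x ≡ fromℕ L) × (x' ≡ zero))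

  next : ∀ {L} (x : Fin (suc L)) → Σ (Fin (suc L)) (Next x)
  next {zero} zero = zero , inj₂ (refl , refl)
  next {suc L} zero = suc zero , inj₁ (zero , refl , refl)
  next {suc L} (suc x) with next {L} x
  ... | _ , inj₁ (i , e , _) = suc (suc i) , inj₁ (suc i , cong suc e , refl)
  ... | _ , inj₂ (e , _) = zero , inj₂ (cong suc e , refl)

  previous : ∀ {L} (x' : Fin (suc L)) → Σ (Fin (suc L)) (λ x → Next x x')
  previous {L} zero = fromℕ L , inj₂ (refl , refl)
  previous {L} (suc i) = inject₁ i , inj₁ (i , refl , refl)

  lookup-rotate : ∀ {L} (v : Vec Bool (suc L)) x x' → Next x x' → lookup (rotate v) x ≡ lookup v x'
  lookup-rotate (b ∷ w) x x' (inj₁ (i , refl , refl)) = lookup-inject w i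
    where
    lookup-inject : ∀ {L} (w : Vec Bool L) (i : Fin L) → lookup (w ∷ʳ b) (inject₁ i) ≡ lookup w i
    lookup-inject (_ ∷ w) zero = refl
    lookup-inject (_ ∷ w) (suc i) = lookup-inject w i
  lookup-rotate (b ∷ w) x x' (inj₂ (refl , refl)) = lookup-last w
    where
    lookup-last : ∀ {L} (w : Vec Bool L) → lookup (w ∷ʳ b) (fromℕ L) ≡ b
    lookup-last [] = refl
    lookup-last (_ ∷ w) = lookup-last w

  Next-injective : ∀ {L} x x' y y' → Next {L} x x' → Next {L} y y' → toℕ x ≡ toℕ y → toℕ x' ≡ toℕ y'
  Next-injective x x' y y' (inj₁ (i , refl , refl)) (inj₁ (j , refl , refl)) e =
    cong suc (trans (sym (toℕ-inject₁ i)) (trans e (toℕ-inject₁ j)))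
  Next-injective {L} x x' y y' (inj₁ (i , refl , refl)) (inj₂ (refl , refl)) e =
    ⊥-elim (ℕP.<-irrefl (trans (sym (toℕ-inject₁ i)) (trans e (toℕ-fromℕ L))) (toℕ<n i))
  Next-injective {L} x x' y y' (inj₂ (refl , refl)) (inj₁ (j , refl , refl)) e =
    ⊥-elim (ℕP.<-irrefl (trans (sym (toℕ-inject₁ j)) (trans (sym e) (toℕ-fromℕ L))) (toℕ<n j))
  Next-injective x x' y y' (inj₂ (refl , refl)) (inj₂ (refl , refl)) e = refl

  Next-functional : ∀ {L} x x' y y' → Next {L} x x' → Next {L} y y' → toℕ x' ≡ toℕ y' → toℕ x ≡ toℕ y
  Next-functional x x' y y' (inj₁ (i , refl , refl)) (inj₁ (j , refl , refl)) e =
    trans (toℕ-inject₁ i) (trans (ℕP.suc-injective e) (sym (toℕ-inject₁ j)))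
  Next-functional x x' y y' (inj₁ (i , refl , refl)) (inj₂ (refl , refl)) ()
  Next-functional x x' y y' (inj₂ (refl , refl)) (inj₁ (j , refl , refl)) ()
  Next-functional x x' y y' (inj₂ (refl , refl)) (inj₂ (refl , refl)) e = refl

  -- ∣i - L∣ + (i + 1) = L + 1: the two arcs between i and L cover the circle.
  arcs : ∀ {L} (i : Fin L) → ∣ toℕ i - L ∣ + suc (toℕ i) ≡ suc L
  arcs {L} i = begin
    ∣ toℕ i - L ∣ + suc (toℕ i)              ≡⟨ cong (λ t → ∣ toℕ i - t ∣ + suc (toℕ i)) L≡i+[d+1] ⟩
    ∣ toℕ i - toℕ i + suc d ∣ + suc (toℕ i)  ≡⟨ cong (_+ suc (toℕ i)) (ℕP.∣m-m+n∣≡n (toℕ i) (suc d)) ⟩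
    suc d + suc (toℕ i)                      ≡⟨ regroup d (toℕ i) ⟩
    suc (suc (toℕ i) + d)                    ≡⟨ cong suc i+1+d≡L ⟩
    suc L                                    ∎
    where
    open ≡-Reasoning
    d = L ∸ suc (toℕ i)
    i+1+d≡L : suc (toℕ i) + d ≡ L
    i+1+d≡L = ℕP.m+[n∸m]≡n (toℕ<n i)
    L≡i+[d+1] : L ≡ toℕ i + suc d
    L≡i+[d+1] = trans (sym i+1+d≡L) (sym (ℕP.+-suc (toℕ i) d))
    regroup : ∀ d i → suc d + suc i ≡ suc (suc i + d)
    regroup = ℕ-Solver.solve-∀

  -- Cyclic distances are preserved by Next, up to complementation.
  gapOK-Next : ∀ s {L} x x' y y' → Next {L} x x' → Next {L} y y' →
               gapOK s (suc L) ∣ toℕ x - toℕ y ∣ ≡ gapOK s (suc L) ∣ toℕ x' - toℕ y' ∣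
  gapOK-Next s {L} x x' y y' (inj₁ (i , refl , refl)) (inj₁ (j , refl , refl)) =
    cong₂ (λ a b → gapOK s (suc L) ∣ a - b ∣) (toℕ-inject₁ i) (toℕ-inject₁ j)
  gapOK-Next s {L} x x' y y' (inj₁ (i , refl , refl)) (inj₂ (refl , refl)) =
    trans (cong₂ (λ a b → gapOK s (suc L) ∣ a - b ∣) (toℕ-inject₁ i) (toℕ-fromℕ L))
          (gapOK-complement s (suc L) _ _ (arcs i))
  gapOK-Next s {L} x x' y y' (inj₂ (refl , refl)) (inj₁ (j , refl , refl)) =
    trans (cong₂ (λ a b → gapOK s (suc L) ∣ a - b ∣) (toℕ-fromℕ L) (toℕ-inject₁ j))
          (trans (cong (gapOK s (suc L)) (ℕP.∣-∣-comm L (toℕ j))) (gapOK-complement s (suc L) _ _ (arcs j)))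
  gapOK-Next s {L} x x' y y' (inj₂ (refl , refl)) (inj₂ (refl , refl)) =
    cong (gapOK s (suc L)) (ℕP.∣n-n∣≡0 (toℕ (fromℕ L)))

  Separated-rotate : ∀ s {L} (v : Vec Bool (suc L)) → Separated s (suc L) v → Separated s (suc L) (rotate v)
  Separated-rotate s v h x y vx vy x≢y with next x | next y
  ... | x' , nx | y' , ny =
    trans (gapOK-Next s x x' y y' nx ny)
          (h x' y' (trans (sym (lookup-rotate v x x' nx)) vx) (trans (sym (lookup-rotate v y y' ny)) vy)
             (λ e → x≢y (Next-functional x x' y y' nx ny e)))

  Separated-unrotate : ∀ s {L} (v : Vec Bool (suc L)) → Separated s (suc L) (rotate v) → Separated s (suc L) v
  Separated-unrotate s v h x' y' vx vy x'≢y' with previous x' | previous y'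
  ... | x , nx | y , ny =
    trans (sym (gapOK-Next s x x' y y' nx ny))
          (h x y (trans (lookup-rotate v x x' nx) vx) (trans (lookup-rotate v y y' ny) vy)
             (λ e → x'≢y' (Next-injective x x' y y' nx ny e)))

  separated-rotate : ∀ s {L} (v : Vec Bool (suc L)) → separatedCircle s (suc L) (rotate v) ≡ separatedCircle s (suc L) v
  separated-rotate s v = separated-ext s _ (rotate v) v (Separated-unrotate s v) (Separated-rotate s v)

  size-rotate : ∀ {L} (v : Vec Bool (suc L)) → ∣ rotate v ∣ ≡ ∣ v ∣
  size-rotate (b ∷ w) = size-snoc w b
    where
    size-snoc : ∀ {L} (w : Vec Bool L) b → ∣ w ∷ʳ b ∣ ≡ ∣ b ∷ w ∣
    size-snoc [] true = refl
    size-snoc [] false = refl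
    size-snoc (true ∷ w) true = cong suc (size-snoc w true)
    size-snoc (true ∷ w) false = cong suc (size-snoc w false)
    size-snoc (false ∷ w) true = size-snoc w true
    size-snoc (false ∷ w) false = size-snoc w false

  sumSubsets-rotate : ∀ L h → sumSubsets (suc L) (λ v → h (rotate v)) ≡ sumSubsets (suc L) h
  sumSubsets-rotate L h = sym (split-last L h)
    where
    split-last : ∀ L h → sumSubsets (suc L) h
                         ≡ sumSubsets L (λ w → h (w ∷ʳ true)) + sumSubsets L (λ w → h (w ∷ʳ false))
    split-last zero h = refl
    split-last (suc L) h =
      trans (cong₂ _+_ (split-last L (λ v → h (true ∷ v))) (split-last L (λ v → h (false ∷ v))))
            (swap-middle (sumSubsets L (λ w → h (true ∷ (w ∷ʳ true)))) (sumSubsets L (λ w → h (true ∷ (w ∷ʳ false))))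
                         (sumSubsets L (λ w → h (false ∷ (w ∷ʳ true)))) (sumSubsets L (λ w → h (false ∷ (w ∷ʳ false)))))
      where
      swap-middle : ∀ a b c d → (a + b) + (c + d) ≡ (a + c) + (b + d)
      swap-middle = ℕ-Solver.solve-∀

-- Rotation shows pointedCount does not depend on a, and double counting the
-- pairs (point, set containing it) gives  m · pointedCount m 0 i = i · cycleCount m i.
module PointCounts (s : ℕ) where

  open import Data.Bool using (Bool; true; false; _∧_; T)
  open import Data.Bool.Properties using (∧-zeroʳ)
  open import Data.Nat using (ℕ; zero; suc; _+_; _*_; _≡ᵇ_)
  import Data.Nat.Properties as ℕP
  import Data.Nat.Tactic.RingSolver as ℕ-Solver
  open import Data.Empty using (⊥; ⊥-elim)
  open import Data.Fin using (Fin; zero; suc; toℕ; inject₁)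
  open import Data.Fin.Properties using (toℕ-inject₁)
  open import Data.Fin.Subset using (∣_∣)
  open import Data.Vec using (Vec; []; _∷_; lookup; replicate)
  open import Data.Product using (_,_)
  open import Data.Sum using (inj₁)
  open import Function using (_∘_)
  open import Relation.Binary.PropositionalEquality
  open ≡-Reasoning
  open Sums
  open Decomposition using (separatedCircle; countSubsets; 𝟙-∧)
  open CircleSeparation using (separated-complete)
  open Rotation

  -- the one-circle counts f and g of the overview
  cycleCount : (m : ℕ) → ℕ → ℕ
  cycleCount m = countSubsets m (separatedCircle s m)

  pointedCount : (m : ℕ) → Fin m → ℕ → ℕ
  pointedCount m a = countSubsets m (λ v → separatedCircle s m v ∧ lookup v a)

  -- Only the empty set has size 0.
  countSubsets-0 : ∀ m (X : Vec Bool m → Bool) → countSubsets m X 0 ≡ 𝟙 (X (replicate m false))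
  countSubsets-0 zero X = ℕP.*-identityʳ _
  countSubsets-0 (suc m) X =
    trans (cong (_+ countSubsets m (X ∘ (false ∷_)) 0)
                (trans (sumSubsets-cong m _ _ (λ v → ℕP.*-zeroʳ (𝟙 (X (true ∷ v))))) (sumSubsets-0 m)))
          (countSubsets-0 m (X ∘ (false ∷_)))

  cycleCount-0 : ∀ m → cycleCount m 0 ≡ 1
  cycleCount-0 m =
    trans (countSubsets-0 m (separatedCircle s m))
          (cong 𝟙 (separated-complete s m (replicate m false) (λ x y vx → ⊥-elim (empty x vx))))
    where
    empty : ∀ {m} (x : Fin m) → lookup (replicate m false) x ≡ true → ⊥
    empty zero ()
    empty (suc x) = empty x

  pointedCount-0 : ∀ m a → pointedCount m a 0 ≡ 0
  pointedCount-0 m a = trans (sumSubsets-cong m _ _ summand-0) (sumSubsets-0 m)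
    where
    nonempty : ∀ {m} (v : Vec Bool m) a → lookup v a ≡ true → (∣ v ∣ ≡ᵇ 0) ≡ false
    nonempty (true ∷ v) zero e = refl
    nonempty (true ∷ v) (suc a) e = refl
    nonempty (false ∷ v) (suc a) e = nonempty v a e
    summand-0 : ∀ v → 𝟙 (separatedCircle s m v ∧ lookup v a) * 𝟙 (∣ v ∣ ≡ᵇ 0) ≡ 0
    summand-0 v with lookup v a in e
    ... | true = trans (cong (λ t → 𝟙 (separatedCircle s m v ∧ true) * 𝟙 t) (nonempty v a e))
                       (ℕP.*-zeroʳ (𝟙 (separatedCircle s m v ∧ true)))
    ... | false = cong (λ t → 𝟙 t * 𝟙 (∣ v ∣ ≡ᵇ 0)) (∧-zeroʳ (separatedCircle s m v))

  pointedCount-rotate : ∀ L (i : Fin L) c → pointedCount (suc L) (inject₁ i) c ≡ pointedCount (suc L) (suc i) c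
  pointedCount-rotate L i c =
    trans (sym (sumSubsets-rotate L (λ v → 𝟙 (separatedCircle s (suc L) v ∧ lookup v (inject₁ i)) * 𝟙 (∣ v ∣ ≡ᵇ c))))
      (sumSubsets-cong (suc L) _ _ (λ v → cong₂ (λ x y → 𝟙 x * 𝟙 (y ≡ᵇ c))
          (cong₂ _∧_ (separated-rotate s v) (lookup-rotate v (inject₁ i) (suc i) (inj₁ (i , refl , refl))))
          (size-rotate v)))

  pointedCount-any : ∀ L (a : Fin (suc L)) c → pointedCount (suc L) a c ≡ pointedCount (suc L) zero c
  pointedCount-any L a c = by-position L (toℕ a) a refl
    where
    by-position : ∀ L t (a : Fin (suc L)) → toℕ a ≡ t → pointedCount (suc L) a c ≡ pointedCount (suc L) zero c
    by-position L t zero e = refl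
    by-position (suc L) (suc t) (suc i) e =
      trans (sym (pointedCount-rotate (suc L) i c))
            (by-position (suc L) t (inject₁ i) (trans (toℕ-inject₁ i) (ℕP.suc-injective e)))

  sumFin : ∀ m → (Fin m → ℕ) → ℕ
  sumFin zero φ = 0
  sumFin (suc m) φ = φ zero + sumFin m (φ ∘ suc)

  sumFin-cong : ∀ m φ ψ → (∀ i → φ i ≡ ψ i) → sumFin m φ ≡ sumFin m ψ
  sumFin-cong zero φ ψ e = refl
  sumFin-cong (suc m) φ ψ e = cong₂ _+_ (e zero) (sumFin-cong m (φ ∘ suc) (ψ ∘ suc) (e ∘ suc))

  sumFin-const : ∀ m c → sumFin m (λ _ → c) ≡ m * c
  sumFin-const zero c = refl
  sumFin-const (suc m) c = cong (c +_) (sumFin-const m c)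

  sumFin-* : ∀ m c φ → sumFin m (λ a → c * φ a) ≡ c * sumFin m φ
  sumFin-* zero c φ = sym (ℕP.*-zeroʳ c)
  sumFin-* (suc m) c φ = trans (cong (c * φ zero +_) (sumFin-* m c (φ ∘ suc))) (sym (ℕP.*-distribˡ-+ c (φ zero) _))

  sumFin-lookup : ∀ {m} (v : Vec Bool m) → sumFin m (λ a → 𝟙 (lookup v a)) ≡ ∣ v ∣
  sumFin-lookup [] = refl
  sumFin-lookup (true ∷ v) = cong suc (sumFin-lookup v)
  sumFin-lookup (false ∷ v) = sumFin-lookup v

  sumSubsets-sumFin : ∀ n m (h : Vec Bool n → Fin m → ℕ) →
                      sumSubsets n (λ v → sumFin m (h v)) ≡ sumFin m (λ a → sumSubsets n (λ v → h v a))
  sumSubsets-sumFin n zero h = sumSubsets-0 n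
  sumSubsets-sumFin n (suc m) h =
    trans (sumSubsets-+ n (λ v → h v zero) (λ v → sumFin m (h v ∘ suc)))
          (cong (sumSubsets n (λ v → h v zero) +_) (sumSubsets-sumFin n m (λ v → h v ∘ suc)))

  size-bracket : ∀ d c → d * 𝟙 (d ≡ᵇ c) ≡ c * 𝟙 (d ≡ᵇ c)
  size-bracket zero zero = refl
  size-bracket zero (suc c) = sym (ℕP.*-zeroʳ (suc c))
  size-bracket (suc d) zero = ℕP.*-zeroʳ (suc d)
  size-bracket (suc d) (suc c) with d ≡ᵇ c in eq
  ... | true = cong (λ t → suc t * 1) (ℕP.≡ᵇ⇒≡ d c (subst T (sym eq) _))
  ... | false = trans (ℕP.*-zeroʳ (suc d)) (sym (ℕP.*-zeroʳ (suc c)))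

  -- Each separated c-set is counted once for each of its c points.
  double-count : ∀ m c → sumFin m (λ a → pointedCount m a c) ≡ c * cycleCount m c
  double-count m c =
    trans (sym (sumSubsets-sumFin m m (λ v a → 𝟙 (sep v ∧ lookup v a) * 𝟙 (∣ v ∣ ≡ᵇ c))))
          (trans (sumSubsets-cong m _ _ per-set) (sumSubsets-* m (λ v → 𝟙 (sep v) * 𝟙 (∣ v ∣ ≡ᵇ c)) c))
    where
    sep = separatedCircle s m
    regroup : ∀ x y z → x * y * z ≡ z * (x * y)
    regroup = ℕ-Solver.solve-∀
    swap : ∀ x y z → x * (y * z) ≡ y * (x * z)
    swap = ℕ-Solver.solve-∀
    per-set : ∀ v → sumFin m (λ a → 𝟙 (sep v ∧ lookup v a) * 𝟙 (∣ v ∣ ≡ᵇ c)) ≡ c * (𝟙 (sep v) * 𝟙 (∣ v ∣ ≡ᵇ c))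
    per-set v = begin
      sumFin m (λ a → 𝟙 (sep v ∧ lookup v a) * 𝟙 (∣ v ∣ ≡ᵇ c))
        ≡⟨ sumFin-cong m _ _ (λ a → trans (cong (_* 𝟙 (∣ v ∣ ≡ᵇ c)) (𝟙-∧ (sep v) (lookup v a)))
                                          (regroup (𝟙 (sep v)) (𝟙 (lookup v a)) (𝟙 (∣ v ∣ ≡ᵇ c)))) ⟩
      sumFin m (λ a → 𝟙 (∣ v ∣ ≡ᵇ c) * (𝟙 (sep v) * 𝟙 (lookup v a)))
        ≡⟨ sumFin-* m (𝟙 (∣ v ∣ ≡ᵇ c)) _ ⟩
      𝟙 (∣ v ∣ ≡ᵇ c) * sumFin m (λ a → 𝟙 (sep v) * 𝟙 (lookup v a))
        ≡⟨ cong (𝟙 (∣ v ∣ ≡ᵇ c) *_) (trans (sumFin-* m (𝟙 (sep v)) _) (cong (𝟙 (sep v) *_) (sumFin-lookup v))) ⟩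
      𝟙 (∣ v ∣ ≡ᵇ c) * (𝟙 (sep v) * ∣ v ∣)
        ≡⟨ swap (𝟙 (∣ v ∣ ≡ᵇ c)) (𝟙 (sep v)) ∣ v ∣ ⟩
      𝟙 (sep v) * (𝟙 (∣ v ∣ ≡ᵇ c) * ∣ v ∣)
        ≡⟨ cong (𝟙 (sep v) *_) (trans (ℕP.*-comm (𝟙 (∣ v ∣ ≡ᵇ c)) ∣ v ∣) (size-bracket ∣ v ∣ c)) ⟩
      𝟙 (sep v) * (c * 𝟙 (∣ v ∣ ≡ᵇ c))
        ≡⟨ swap (𝟙 (sep v)) c _ ⟩
      c * (𝟙 (sep v) * 𝟙 (∣ v ∣ ≡ᵇ c)) ∎

  -- with pointedCount independent of the point
  double-count-0 : ∀ L c → suc L * pointedCount (suc L) zero c ≡ c * cycleCount (suc L) c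
  double-count-0 L c =
    trans (sym (sumFin-const (suc L) _))
          (trans (sumFin-cong (suc L) _ _ (λ a → sym (pointedCount-any L a c))) (double-count (suc L) c))

-- Subsets of a circle of L + 1 points containing the point 0.  Removing 0
-- leaves a subset w of a line of L points; the set is s-separated iff w has
-- gaps of at least s points between consecutive elements, before its first
-- element and after its last one.  The Boolean recursion  linearOK g L w
-- checks this (g = number of unchosen points since the last chosen one),
-- and counting by this recursion gives a binomial coefficient.
module LinearArrangements (s : ℕ) where

  open import Data.Bool using (Bool; true; false; _∧_)
  open import Data.Bool.Properties using (∧-identityʳ; ∧-zeroʳ)
  open import Data.Nat using (ℕ; zero; suc; _+_; _*_; _∸_; _≤ᵇ_; _≡ᵇ_; _≤_; _<_; z≤n; s≤s; ∣_-_∣; _⊓_)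
  import Data.Nat.Properties as ℕP
  import Data.Nat.Tactic.RingSolver as ℕ-Solver
  open import Data.Empty using (⊥-elim)
  open import Data.Fin using (zero; suc; toℕ)
  open import Data.Fin.Subset using (∣_∣)
  open import Data.Vec using (Vec; []; _∷_; lookup; replicate)
  open import Data.Product using (Σ; _,_; _×_)
  open import Relation.Binary.Definitions using (tri<; tri≈; tri>)
  open import Relation.Nullary using (¬_; yes; no)
  open import Relation.Binary.PropositionalEquality
  open ≡-Reasoning
  open Binomial using (choose)
  open Sums
  open Decomposition using (separatedCircle; countSubsets; 𝟙-∧)
  open CircleSeparation
  open PointCounts s using (pointedCount; countSubsets-0)

  -- Scanning w from the left with g unchosen points seen since the last
  -- chosen one (or since 0): a chosen point needs g ≥ s and room for s more
  -- points before the end of the line.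
  linearOK : ℕ → (L : ℕ) → Vec Bool L → Bool
  linearOK g zero [] = true
  linearOK g (suc L) (true ∷ w) = (s ≤ᵇ g) ∧ ((s ≤ᵇ L) ∧ linearOK 0 L w)
  linearOK g (suc L) (false ∷ w) = linearOK (suc g) L w

  -- The same conditions stated directly: gaps between chosen points, the gap
  -- from the start (with g extra points before it), the gap to the end.
  Gaps End : (L : ℕ) → Vec Bool L → Set
  Start : ℕ → (L : ℕ) → Vec Bool L → Set
  Gaps L w = ∀ x y → lookup w x ≡ true → lookup w y ≡ true → toℕ x < toℕ y → s + toℕ x < toℕ y
  Start g L w = ∀ y → lookup w y ≡ true → s ≤ toℕ y + g
  End L w = ∀ y → lookup w y ≡ true → toℕ y + s < L

  LinearSeparated : ℕ → (L : ℕ) → Vec Bool L → Set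
  LinearSeparated g L w = Gaps L w × Start g L w × End L w

  gaps-cons-true : ∀ L (w : Vec Bool L) → Start 0 L w → Gaps L w → Gaps (suc L) (true ∷ w)
  gaps-cons-true L w start gaps zero zero _ _ ()
  gaps-cons-true L w start gaps zero (suc y) _ wy _ =
    s≤s (subst₂ _≤_ (sym (ℕP.+-identityʳ s)) (ℕP.+-identityʳ (toℕ y)) (start y wy))
  gaps-cons-true L w start gaps (suc x) zero _ _ ()
  gaps-cons-true L w start gaps (suc x) (suc y) wx wy (s≤s lt) =
    subst (_< suc (toℕ y)) (sym (ℕP.+-suc s (toℕ x))) (s≤s (gaps x y wx wy lt))

  gaps-cons-false : ∀ L (w : Vec Bool L) → Gaps L w → Gaps (suc L) (false ∷ w)
  gaps-cons-false L w gaps zero _ () _ _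
  gaps-cons-false L w gaps (suc x) zero _ () _
  gaps-cons-false L w gaps (suc x) (suc y) wx wy (s≤s lt) =
    subst (_< suc (toℕ y)) (sym (ℕP.+-suc s (toℕ x))) (s≤s (gaps x y wx wy lt))

  start-cons-true : ∀ g L (w : Vec Bool L) → s ≤ g → Start 0 L w → Start g (suc L) (true ∷ w)
  start-cons-true g L w s≤g start zero _ = s≤g
  start-cons-true g L w s≤g start (suc y) wy = ℕP.≤-trans (start y wy) (ℕP.+-mono-≤ (ℕP.n≤1+n (toℕ y)) z≤n)

  start-cons-false : ∀ g L (w : Vec Bool L) → Start (suc g) L w → Start g (suc L) (false ∷ w)
  start-cons-false g L w start zero ()
  start-cons-false g L w start (suc y) wy = subst (s ≤_) (ℕP.+-suc (toℕ y) g) (start y wy)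

  end-cons-true : ∀ L (w : Vec Bool L) → s ≤ L → End L w → End (suc L) (true ∷ w)
  end-cons-true L w s≤L end zero _ = s≤s s≤L
  end-cons-true L w s≤L end (suc y) wy = s≤s (end y wy)

  end-cons-false : ∀ L (w : Vec Bool L) → End L w → End (suc L) (false ∷ w)
  end-cons-false L w end zero ()
  end-cons-false L w end (suc y) wy = s≤s (end y wy)

  linearOK-sound : ∀ g L w → linearOK g L w ≡ true → LinearSeparated g L w
  linearOK-sound g zero [] e = (λ ()) , (λ ()) , (λ ())
  linearOK-sound g (suc L) (true ∷ w) e with linearOK-sound 0 L w (∧-right {s ≤ᵇ L} (∧-right {s ≤ᵇ g} e))
  ... | gaps , start , end =
    gaps-cons-true L w start gaps ,
    start-cons-true g L w (≤ᵇ-sound s g (∧-left e)) start ,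
    end-cons-true L w (≤ᵇ-sound s L (∧-left (∧-right {s ≤ᵇ g} e))) end
  linearOK-sound g (suc L) (false ∷ w) e with linearOK-sound (suc g) L w e
  ... | gaps , start , end = gaps-cons-false L w gaps , start-cons-false g L w start , end-cons-false L w end

  gaps-tail : ∀ L b (w : Vec Bool L) → Gaps (suc L) (b ∷ w) → Gaps L w
  gaps-tail L b w gaps x y wx wy lt =
    ℕP.≤-pred (subst (_< suc (toℕ y)) (ℕP.+-suc s (toℕ x)) (gaps (suc x) (suc y) wx wy (s≤s lt)))

  end-tail : ∀ L b (w : Vec Bool L) → End (suc L) (b ∷ w) → End L w
  end-tail L b w end y wy = ℕP.≤-pred (end (suc y) wy)

  linearOK-complete : ∀ g L w → LinearSeparated g L w → linearOK g L w ≡ true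
  linearOK-complete g zero [] _ = refl
  linearOK-complete g (suc L) (true ∷ w) (gaps , start , end) =
    ∧-intro (≤ᵇ-complete (start zero refl))
      (∧-intro (≤ᵇ-complete (ℕP.≤-pred (end zero refl)))
        (linearOK-complete 0 L w (gaps-tail L true w gaps , start-tail , end-tail L true w end)))
    where
    start-tail : Start 0 L w
    start-tail y wy =
      subst (s ≤_) (sym (ℕP.+-identityʳ (toℕ y)))
        (ℕP.≤-pred (subst (_≤ suc (toℕ y)) (cong suc (ℕP.+-identityʳ s)) (gaps zero (suc y) refl wy (s≤s z≤n))))
  linearOK-complete g (suc L) (false ∷ w) (gaps , start , end) =
    linearOK-complete (suc g) L w
      (gaps-tail L false w gaps , (λ y wy → subst (s ≤_) (sym (ℕP.+-suc (toℕ y) g)) (start (suc y) wy)) ,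
       end-tail L false w end)

  -- Two points a < a + d of the line (points a+1, a+d+1 of the circle) with
  -- the linear conditions are far apart on the circle.
  gapOK-ordered : ∀ L a d → s + a < a + d → s ≤ a → (a + d) + s < L → gapOK s (suc L) ∣ a - (a + d) ∣ ≡ true
  gapOK-ordered L a d gap start end =
    subst (λ t → gapOK s (suc L) t ≡ true) (sym (ℕP.∣m-m+n∣≡n a d))
      (∧-intro (≤ᵇ-complete s<d) (≤ᵇ-complete (s≤s s+d≤L)))
    where
    s<d : suc s ≤ d
    s<d = ℕP.+-cancelʳ-≤ a (suc s) d (subst (suc s + a ≤_) (ℕP.+-comm a d) gap)
    s+d≤L : s + d ≤ L
    s+d≤L = ℕP.≤-trans (ℕP.+-monoˡ-≤ d start) (ℕP.≤-trans (ℕP.m≤m+n (a + d) s) (ℕP.<⇒≤ end))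

  split< : ∀ a b → a < b → Σ ℕ (λ d → b ≡ a + d)
  split< a b lt = (b ∸ a) , sym (ℕP.m+[n∸m]≡n (ℕP.<⇒≤ lt))

  end-rearranged : ∀ L y → y + s < L → suc s + suc y ≤ suc L
  end-rearranged L y lt = s≤s (subst (_≤ L) (sym (trans (ℕP.+-suc s y) (cong suc (ℕP.+-comm s y)))) lt)

  ordered-far : ∀ L w → LinearSeparated 0 L w → ∀ x y → lookup w x ≡ true → lookup w y ≡ true →
                toℕ x < toℕ y → gapOK s (suc L) ∣ toℕ x - toℕ y ∣ ≡ true
  ordered-far L w (gaps , start , end) x y wx wy lt with split< (toℕ x) (toℕ y) lt
  ... | d , e =
    subst (λ t → gapOK s (suc L) ∣ toℕ x - t ∣ ≡ true) (sym e)
      (gapOK-ordered L (toℕ x) d (subst (s + toℕ x <_) e (gaps x y wx wy lt))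
         (subst (s ≤_) (ℕP.+-identityʳ _) (start x wx)) (subst (λ t → t + s < L) e (end y wy)))

  pointed-separated : ∀ L w → LinearSeparated 0 L w → Separated s (suc L) (true ∷ w)
  pointed-separated L w lin zero zero _ _ ne = ⊥-elim (ne refl)
  pointed-separated L w (gaps , start , end) zero (suc y) _ wy _ =
    ∧-intro (≤ᵇ-complete (s≤s (subst (s ≤_) (ℕP.+-identityʳ (toℕ y)) (start y wy))))
            (≤ᵇ-complete (end-rearranged L (toℕ y) (end y wy)))
  pointed-separated L w (gaps , start , end) (suc x) zero wx _ _ =
    ∧-intro (≤ᵇ-complete (s≤s (subst (s ≤_) (ℕP.+-identityʳ (toℕ x)) (start x wx))))
            (≤ᵇ-complete (end-rearranged L (toℕ x) (end x wx)))
  pointed-separated L w lin (suc x) (suc y) wx wy ne with ℕP.<-cmp (toℕ x) (toℕ y)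
  ... | tri< lt _ _ = ordered-far L w lin x y wx wy lt
  ... | tri≈ _ eq _ = ⊥-elim (ne (cong suc eq))
  ... | tri> _ _ gt =
    subst (λ t → gapOK s (suc L) t ≡ true) (ℕP.∣-∣-comm (toℕ y) (toℕ x)) (ordered-far L w lin y x wy wx gt)

  separated-pointed : ∀ L w → Separated s (suc L) (true ∷ w) → LinearSeparated 0 L w
  separated-pointed L w sep = gaps , start , end
    where
    gaps : Gaps L w
    gaps x y wx wy lt with split< (toℕ x) (toℕ y) lt
    ... | d , e = subst (suc (s + toℕ x) ≤_) (sym (trans e (ℕP.+-comm (toℕ x) d))) (ℕP.+-monoˡ-≤ (toℕ x) s<d)
      where
      far : gapOK s (suc L) ∣ toℕ x - toℕ y ∣ ≡ true
      far = sep (suc x) (suc y) wx wy (λ eq → ℕP.<-irrefl (ℕP.suc-injective eq) lt)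
      s<d : suc s ≤ d
      s<d = subst (suc s ≤_) (trans (cong (λ t → ∣ toℕ x - t ∣) e) (ℕP.∣m-m+n∣≡n (toℕ x) d))
                  (≤ᵇ-sound _ _ (∧-left far))
    start : Start 0 L w
    start y wy = subst (s ≤_) (sym (ℕP.+-identityʳ _))
                       (ℕP.≤-pred (≤ᵇ-sound _ _ (∧-left (sep zero (suc y) refl wy (λ ())))))
    end : End L w
    end y wy = subst (_≤ L) (trans (ℕP.+-suc s (toℕ y)) (cong suc (ℕP.+-comm s (toℕ y))))
                     (ℕP.≤-pred (≤ᵇ-sound _ _ (∧-right {suc s ≤ᵇ suc (toℕ y)} (sep zero (suc y) refl wy (λ ())))))

  separatedCircle-pointed : ∀ L w → separatedCircle s (suc L) (true ∷ w) ≡ linearOK 0 L w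
  separatedCircle-pointed L w =
    bool-ext (λ e → linearOK-complete 0 L w (separated-pointed L w (separated-sound s (suc L) (true ∷ w) e)))
             (λ e → separated-complete s (suc L) (true ∷ w) (pointed-separated L w (linearOK-sound 0 L w e)))

  linearCount : ℕ → (L : ℕ) → ℕ → ℕ
  linearCount g L = countSubsets L (linearOK g L)

  linearOK-empty : ∀ g L → linearOK g L (replicate L false) ≡ true
  linearOK-empty g zero = refl
  linearOK-empty g (suc L) = linearOK-empty (suc g) L

  linearCount-0 : ∀ g L → linearCount g L 0 ≡ 1
  linearCount-0 g L = trans (countSubsets-0 L (linearOK g L)) (cong 𝟙 (linearOK-empty g L))

  -- Either the first point is chosen (then the rest is counted from g = 0)
  -- or it is not (then g grows by one).
  linearCount-step : ∀ g L r → linearCount g (suc L) (suc r)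
                     ≡ 𝟙 (s ≤ᵇ g) * (𝟙 (s ≤ᵇ L) * linearCount 0 L r) + linearCount (suc g) L (suc r)
  linearCount-step g L r = cong (_+ linearCount (suc g) L (suc r)) (begin
    sumSubsets L (λ w → 𝟙 ((s ≤ᵇ g) ∧ ((s ≤ᵇ L) ∧ linearOK 0 L w)) * 𝟙 (∣ w ∣ ≡ᵇ r))
      ≡⟨ sumSubsets-cong L _ _ brackets ⟩
    sumSubsets L (λ w → 𝟙 (s ≤ᵇ g) * (𝟙 (s ≤ᵇ L) * (𝟙 (linearOK 0 L w) * 𝟙 (∣ w ∣ ≡ᵇ r))))
      ≡⟨ sumSubsets-* L _ (𝟙 (s ≤ᵇ g)) ⟩
    𝟙 (s ≤ᵇ g) * sumSubsets L (λ w → 𝟙 (s ≤ᵇ L) * (𝟙 (linearOK 0 L w) * 𝟙 (∣ w ∣ ≡ᵇ r)))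
      ≡⟨ cong (𝟙 (s ≤ᵇ g) *_) (sumSubsets-* L _ (𝟙 (s ≤ᵇ L))) ⟩
    𝟙 (s ≤ᵇ g) * (𝟙 (s ≤ᵇ L) * linearCount 0 L r) ∎)
    where
    regroup : ∀ a b c d → a * (b * c) * d ≡ a * (b * (c * d))
    regroup = ℕ-Solver.solve-∀
    brackets : ∀ w → 𝟙 ((s ≤ᵇ g) ∧ ((s ≤ᵇ L) ∧ linearOK 0 L w)) * 𝟙 (∣ w ∣ ≡ᵇ r)
                     ≡ 𝟙 (s ≤ᵇ g) * (𝟙 (s ≤ᵇ L) * (𝟙 (linearOK 0 L w) * 𝟙 (∣ w ∣ ≡ᵇ r)))
    brackets w =
      trans (cong (_* 𝟙 (∣ w ∣ ≡ᵇ r)) (trans (𝟙-∧ (s ≤ᵇ g) _) (cong (𝟙 (s ≤ᵇ g) *_) (𝟙-∧ (s ≤ᵇ L) _))))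
            (regroup (𝟙 (s ≤ᵇ g)) (𝟙 (s ≤ᵇ L)) (𝟙 (linearOK 0 L w)) (𝟙 (∣ w ∣ ≡ᵇ r)))

  -- Closed form of linearCount: with g points already free before the line
  -- (only min(g,s) of them matter), (r+1) points fit in C(L + min(g,s) - s(r+2), r+1) ways.
  linearClosed : ℕ → ℕ → ℕ → ℕ
  linearClosed g L zero = 1
  linearClosed g L (suc r) = choose ((L + (g ⊓ s)) ∸ s * suc (suc r)) (suc r)

  s*-step : ∀ r → s * suc (suc r) ≡ s * suc r + s
  s*-step r = trans (ℕP.*-suc s (suc r)) (ℕP.+-comm s (s * suc r))

  s≤s*[1+r] : ∀ r → s ≤ s * suc r
  s≤s*[1+r] r = ℕP.m≤m*n s (suc r)

  ≤ᵇ-false : ∀ {m n} → ¬ m ≤ n → (m ≤ᵇ n) ≡ false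
  ≤ᵇ-false {m} {n} m≰n with m ≤ᵇ n in e
  ... | true = ⊥-elim (m≰n (≤ᵇ-sound m n e))
  ... | false = refl

  -- Pascal's rule for the closed form, including the degenerate case in
  -- which the line is too short for r + 2 points.
  linearClosed-pascal : ∀ L r → 𝟙 (s ≤ᵇ L) * linearClosed 0 L r + choose ((L + s) ∸ s * suc (suc r)) (suc r)
                                ≡ choose (suc (L + s) ∸ s * suc (suc r)) (suc r)
  linearClosed-pascal L r with s * suc (suc r) ℕP.≤? L + s
  ... | yes fits =
    trans (cong (_+ choose Q (suc r)) first) (sym (cong (λ t → choose t (suc r)) (ℕP.+-∸-assoc 1 fits)))
    where
    Q = (L + s) ∸ s * suc (suc r)
    s≤L : s ≤ L
    s≤L = ℕP.+-cancelʳ-≤ s s L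
            (ℕP.≤-trans (subst (s + s ≤_) (sym (s*-step r)) (ℕP.+-monoˡ-≤ s (s≤s*[1+r] r))) fits)
    closed-0 : ∀ r → linearClosed 0 L r ≡ choose ((L + s) ∸ s * suc (suc r)) r
    closed-0 zero = refl
    closed-0 (suc r') = cong (λ t → choose t (suc r'))
      (trans (cong (_∸ s * suc (suc r')) (ℕP.+-identityʳ L))
        (sym (trans (cong ((L + s) ∸_) (s*-step (suc r')))
              (trans (cong₂ _∸_ (ℕP.+-comm L s) (ℕP.+-comm (s * suc (suc r')) s)) (ℕP.[m+n]∸[m+o]≡n∸o s L _)))))
    first : 𝟙 (s ≤ᵇ L) * linearClosed 0 L r ≡ choose Q r
    first = trans (cong (λ t → 𝟙 t * linearClosed 0 L r) (≤ᵇ-complete s≤L)) (trans (ℕP.+-identityʳ _) (closed-0 r))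
  ... | no too-short =
    trans (cong₂ _+_ (vanishes r short) (cong (λ t → choose t (suc r)) (ℕP.m≤n⇒m∸n≡0 (ℕP.<⇒≤ short))))
          (sym (cong (λ t → choose t (suc r)) (ℕP.m≤n⇒m∸n≡0 short)))
    where
    short : L + s < s * suc (suc r)
    short = ℕP.≰⇒> too-short
    vanishes : ∀ r → L + s < s * suc (suc r) → 𝟙 (s ≤ᵇ L) * linearClosed 0 L r ≡ 0
    vanishes zero lt with s ≤ᵇ L in eq
    ... | false = refl
    ... | true = ⊥-elim (ℕP.<-irrefl refl (ℕP.<-≤-trans lt
                   (subst (_≤ L + s) (sym (trans (s*-step 0) (cong (_+ s) (ℕP.*-identityʳ s))))
                          (ℕP.+-monoˡ-≤ s (≤ᵇ-sound s L eq)))))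
    vanishes (suc r') lt =
      trans (cong (λ t → 𝟙 (s ≤ᵇ L) * choose t (suc r'))
                  (ℕP.m≤n⇒m∸n≡0 (subst (_≤ s * suc (suc r')) (sym (ℕP.+-identityʳ L)) (ℕP.<⇒≤ L<))))
            (ℕP.*-zeroʳ (𝟙 (s ≤ᵇ L)))
      where
      L< : L < s * suc (suc r')
      L< = ℕP.+-cancelʳ-< s L _ (subst (L + s <_) (s*-step (suc r')) lt)

  linearCount-closed : ∀ L g r → linearCount g L r ≡ linearClosed g L r
  linearCount-closed L g zero = linearCount-0 g L
  linearCount-closed zero g (suc r) =
    sym (cong (λ t → choose t (suc r)) (ℕP.m≤n⇒m∸n≡0 (ℕP.≤-trans (ℕP.m⊓n≤n g s) (s≤s*[1+r] (suc r)))))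
  linearCount-closed (suc L) g (suc r) with s ℕP.≤? g
  ... | yes s≤g = begin
    linearCount g (suc L) (suc r)
      ≡⟨ linearCount-step g L r ⟩
    𝟙 (s ≤ᵇ g) * (𝟙 (s ≤ᵇ L) * linearCount 0 L r) + linearCount (suc g) L (suc r)
      ≡⟨ cong₂ (λ t u → 𝟙 t * (𝟙 (s ≤ᵇ L) * linearCount 0 L r) + u) (≤ᵇ-complete s≤g) (linearCount-closed L (suc g) (suc r)) ⟩
    1 * (𝟙 (s ≤ᵇ L) * linearCount 0 L r) + choose ((L + (suc g ⊓ s)) ∸ s * suc (suc r)) (suc r)
      ≡⟨ cong₂ (λ a b → a + choose ((L + b) ∸ s * suc (suc r)) (suc r))
               (trans (ℕP.+-identityʳ _) (cong (𝟙 (s ≤ᵇ L) *_) (linearCount-closed L 0 r)))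
               (ℕP.m≥n⇒m⊓n≡n (ℕP.≤-trans s≤g (ℕP.n≤1+n g))) ⟩
    𝟙 (s ≤ᵇ L) * linearClosed 0 L r + choose ((L + s) ∸ s * suc (suc r)) (suc r)
      ≡⟨ linearClosed-pascal L r ⟩
    choose (suc (L + s) ∸ s * suc (suc r)) (suc r)
      ≡⟨ cong (λ t → choose (suc (L + t) ∸ s * suc (suc r)) (suc r)) (ℕP.m≥n⇒m⊓n≡n s≤g) ⟨
    linearClosed g (suc L) (suc r) ∎
  ... | no s≰g = begin
    linearCount g (suc L) (suc r)
      ≡⟨ linearCount-step g L r ⟩
    𝟙 (s ≤ᵇ g) * (𝟙 (s ≤ᵇ L) * linearCount 0 L r) + linearCount (suc g) L (suc r)
      ≡⟨ cong₂ (λ t u → 𝟙 t * (𝟙 (s ≤ᵇ L) * linearCount 0 L r) + u) (≤ᵇ-false s≰g) (linearCount-closed L (suc g) (suc r)) ⟩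
    choose ((L + (suc g ⊓ s)) ∸ s * suc (suc r)) (suc r)
      ≡⟨ cong (λ t → choose (t ∸ s * suc (suc r)) (suc r)) L+[1+g]≡ ⟩
    linearClosed g (suc L) (suc r) ∎
    where
    g<s = ℕP.≰⇒> s≰g
    L+[1+g]≡ : L + (suc g ⊓ s) ≡ suc L + (g ⊓ s)
    L+[1+g]≡ = trans (cong (L +_) (ℕP.m≤n⇒m⊓n≡m g<s))
                     (trans (ℕP.+-suc L g) (cong (suc L +_) (sym (ℕP.m≤n⇒m⊓n≡m (ℕP.<⇒≤ g<s)))))

  pointedCount-value : ∀ L i → pointedCount (suc L) zero (suc i) ≡ choose (L ∸ s * suc i) i
  pointedCount-value L i =
    trans (cong₂ _+_ (sumSubsets-cong L _ _ (λ w → cong (λ t → 𝟙 t * 𝟙 (∣ w ∣ ≡ᵇ i))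
                                                       (trans (∧-identityʳ _) (separatedCircle-pointed L w))))
                     (trans (sumSubsets-cong L _ _ (λ w → cong (λ t → 𝟙 t * 𝟙 (∣ w ∣ ≡ᵇ suc i))
                                                              (∧-zeroʳ (separatedCircle s (suc L) (false ∷ w)))))
                            (sumSubsets-0 L)))
          (trans (ℕP.+-identityʳ _) (trans (linearCount-closed L 0 i) (closed-at-0 i)))
    where
    closed-at-0 : ∀ i → linearClosed 0 L i ≡ choose (L ∸ s * suc i) i
    closed-at-0 zero = refl
    closed-at-0 (suc i) = cong (λ t → choose (t ∸ s * suc (suc i)) (suc i)) (ℕP.+-identityʳ L)

module Assembly (s : ℕ) (s≥1 : 1 ≤ s) where

  open import Defs
  open import Data.Bool using (true; false; _∧_)
  open import Data.Bool.Properties using (∧-assoc; ∧-comm)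
  open import Data.Vec using (lookup)
  open import Data.Nat as ℕ using (ℕ; zero; suc; _≤_; _∸_; _≡ᵇ_; s≤s)
  import Data.Nat.Properties as ℕP
  import Data.Nat.Tactic.RingSolver as ℕ-Solver
  open import Data.Integer using (+_; _+_; _*_)
  import Data.Integer.Properties as ℤP
  open import Data.Fin using (Fin; zero; suc)
  open import Data.List using (length)
  open import Data.Nat.ListAction using (sum)
  open import Function using (_∘_)
  open import Relation.Binary.PropositionalEquality
  open ≡-Reasoning
  open Binomial
  open IntegerBinomial
  open Convolution
  open CycleSeries s
  open Sums using (𝟙; length-filter; sum-allFamilies; sumFamilies-cong)
  open Decomposition
  open PointCounts s
  open LinearArrangements s using (pointedCount-value)

  split-above : ∀ X N → X ℕ.+ 1 ≤ N → N ≡ X ℕ.+ suc (N ∸ (X ℕ.+ 1))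
  split-above X N le = trans (sym (ℕP.m+[n∸m]≡n le)) (ℕP.+-assoc X 1 _)

  split-above-pred : ∀ L X Q → suc L ≡ X ℕ.+ suc Q → L ∸ X ≡ Q
  split-above-pred L X Q e = trans (cong (_∸ X) (ℕP.suc-injective (trans e (ℕP.+-suc X Q)))) (ℕP.m+n∸m≡n X Q)

  G-value : ∀ N i Q → N ≡ s ℕ.* suc i ℕ.+ suc Q → G (+ N) (suc i) ≡ + choose Q i
  G-value N i Q e =
    trans (cong (λ t → zchoose (predℤ (+ t -ⁿ s ℕ.* suc i)) i) e)
          (cong (λ t → zchoose (predℤ t) i) (-ⁿ-pos (suc Q) (s ℕ.* suc i)))

  pointedCount≡G : ∀ n (a : Fin n) i → s ℕ.* i ℕ.+ 1 ≤ n → + pointedCount n a i ≡ G (+ n) i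
  pointedCount≡G n a zero le = cong +_ (pointedCount-0 n a)
  pointedCount≡G (suc L) a (suc i) le = begin
    + pointedCount (suc L) a (suc i)     ≡⟨ cong +_ (pointedCount-any L a (suc i)) ⟩
    + pointedCount (suc L) zero (suc i)  ≡⟨ cong +_ (pointedCount-value L i) ⟩
    + choose (L ∸ X) i                   ≡⟨ cong (λ t → + choose t i) (split-above-pred L X Q L+1≡X+Q+1) ⟩
    + choose Q i                         ≡⟨ G-value (suc L) i Q L+1≡X+Q+1 ⟨
    G (+ suc L) (suc i)                  ∎
    where
    X = s ℕ.* suc i
    Q = suc L ∸ (X ℕ.+ 1)
    L+1≡X+Q+1 = split-above X (suc L) le

  -- On one circle:  #(s-separated (i+1)-sets) = C(Q+1, i+1) + s·C(Q, i)  where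
  -- L + 1 = s(i+1) + Q + 1; from  (L+1)·C(Q,i) = (i+1)·#  by double counting.
  cycleCount-value : ∀ L i Q → suc L ≡ s ℕ.* suc i ℕ.+ suc Q →
                     cycleCount (suc L) (suc i) ≡ choose (suc Q) (suc i) ℕ.+ s ℕ.* choose Q i
  cycleCount-value L i Q e = ℕP.*-cancelˡ-≡ _ _ (suc i) (begin
    suc i ℕ.* cycleCount (suc L) (suc i)
      ≡⟨ double-count-0 L (suc i) ⟨
    suc L ℕ.* pointedCount (suc L) zero (suc i)
      ≡⟨ cong₂ ℕ._*_ e (trans (pointedCount-value L i) (cong (λ t → choose t i) (split-above-pred L X Q e))) ⟩
    (s ℕ.* suc i ℕ.+ suc Q) ℕ.* choose Q i
      ≡⟨ regroup (suc Q) (choose Q i) i s ⟨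
    suc Q ℕ.* choose Q i ℕ.+ suc i ℕ.* (s ℕ.* choose Q i)
      ≡⟨ cong (ℕ._+ suc i ℕ.* (s ℕ.* choose Q i)) (choose-absorb Q i) ⟨
    suc i ℕ.* choose (suc Q) (suc i) ℕ.+ suc i ℕ.* (s ℕ.* choose Q i)
      ≡⟨ ℕP.*-distribˡ-+ (suc i) (choose (suc Q) (suc i)) (s ℕ.* choose Q i) ⟨
    suc i ℕ.* (choose (suc Q) (suc i) ℕ.+ s ℕ.* choose Q i) ∎)
    where
    X = s ℕ.* suc i
    regroup : ∀ q b i s → q ℕ.* b ℕ.+ suc i ℕ.* (s ℕ.* b) ≡ (s ℕ.* suc i ℕ.+ q) ℕ.* b
    regroup = ℕ-Solver.solve-∀

  cycleCount≡F : ∀ n i → s ℕ.* i ℕ.+ 1 ≤ n → + cycleCount n i ≡ F (+ n) i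
  cycleCount≡F n zero le = cong +_ (cycleCount-0 n)
  cycleCount≡F zero (suc i) le with ℕP.m+n≤o⇒n≤o (s ℕ.* suc i) le
  ... | ()
  cycleCount≡F (suc L) (suc i) le = begin
    + cycleCount (suc L) (suc i)
      ≡⟨ cong +_ (cycleCount-value L i Q L+1≡X+Q+1) ⟩
    + (choose (suc Q) (suc i) ℕ.+ s ℕ.* choose Q i)
      ≡⟨ trans (ℤP.pos-+ (choose (suc Q) (suc i)) (s ℕ.* choose Q i)) (cong (_+_ (+ choose (suc Q) (suc i))) (ℤP.pos-* s (choose Q i))) ⟩
    + choose (suc Q) (suc i) + + s * + choose Q i
      ≡⟨ cong (λ t → zchoose t (suc i) + + s * zchoose (predℤ t) i) L+1-X≡Q+1 ⟨
    F (+ suc L) (suc i) ∎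
    where
    X = s ℕ.* suc i
    Q = suc L ∸ (X ℕ.+ 1)
    L+1≡X+Q+1 = split-above X (suc L) le
    L+1-X≡Q+1 : + suc L -ⁿ X ≡ + suc Q
    L+1-X≡Q+1 = trans (cong (λ t → + t -ⁿ X) L+1≡X+Q+1) (-ⁿ-pos (suc Q) X)

  ∧-swap : ∀ a b c → (a ∧ b) ∧ c ≡ (a ∧ c) ∧ b
  ∧-swap true b c = ∧-comm b c
  ∧-swap false b c = refl

  separatedFamilies : (p : ℕ) (n : Fin p → ℕ) → ℕ → ℕ
  separatedFamilies p n = countFamilies p n (separated s)

  pointedFamilies : (p : ℕ) (n : Fin p → ℕ) (j : Fin p) → Fin (n j) → ℕ → ℕ
  pointedFamilies p n j a = countFamilies p n (λ A → separated s A ∧ member j a A)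

  separatedFamilies-step : ∀ p n m →
    separatedFamilies (suc p) n m ≡ convℕ (cycleCount (n zero)) (separatedFamilies p (n ∘ suc)) m
  separatedFamilies-step p n =
    countFamilies-consF p n (separated s) (separatedCircle s (n zero)) (separated s) (separated-consF s p n)

  pointedFamilies-step-here : ∀ p n a k →
    pointedFamilies (suc p) n zero a k ≡ convℕ (pointedCount (n zero) a) (separatedFamilies p (n ∘ suc)) k
  pointedFamilies-step-here p n a =
    countFamilies-consF p n (λ A → separated s A ∧ member zero a A)
      (λ v → separatedCircle s (n zero) v ∧ lookup v a) (separated s)
      (λ v R → trans (cong (_∧ lookup v a) (separated-consF s p n v R))
                     (∧-swap (separatedCircle s (n zero) v) (separated s R) (lookup v a)))

  pointedFamilies-step-later : ∀ p n j a k →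
    pointedFamilies (suc p) n (suc j) a k ≡ convℕ (cycleCount (n zero)) (pointedFamilies p (n ∘ suc) j a) k
  pointedFamilies-step-later p n j a =
    countFamilies-consF p n (λ A → separated s A ∧ member (suc j) a A)
      (separatedCircle s (n zero)) (λ R → separated s R ∧ member j a R)
      (λ v R → trans (cong (_∧ member j a R) (separated-consF s p n v R))
                     (∧-assoc (separatedCircle s (n zero) v) (separated s R) (member j a R)))

  pointedFamilies-0 : ∀ p n j a → pointedFamilies p n j a 0 ≡ 0
  pointedFamilies-0 (suc p) n zero a =
    trans (pointedFamilies-step-here p n a 0) (cong (ℕ._* separatedFamilies p (n ∘ suc) 0) (pointedCount-0 (n zero) a))
  pointedFamilies-0 (suc p) n (suc j) a =
    trans (pointedFamilies-step-later p n j a 0)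
          (trans (cong (cycleCount (n zero) 0 ℕ.*_) (pointedFamilies-0 p (n ∘ suc) j a)) (ℕP.*-zeroʳ (cycleCount (n zero) 0)))

  room-mono : ∀ {i m} → i ≤ m → s ℕ.* i ℕ.+ 1 ≤ s ℕ.* m ℕ.+ 1
  room-mono le = ℕP.+-monoˡ-≤ 1 (ℕP.*-monoʳ-≤ s le)

  room-strict : ∀ {j k} → j ℕ.< k → s ℕ.* j ℕ.+ 1 ≤ s ℕ.* k
  room-strict {j} j<k =
    ℕP.≤-trans (subst (s ℕ.* j ℕ.+ 1 ≤_) (trans (ℕP.+-comm (s ℕ.* j) s) (sym (ℕP.*-suc s j))) (ℕP.+-monoʳ-≤ (s ℕ.* j) s≥1))
               (ℕP.*-monoʳ-≤ s j<k)

  left≤ : ∀ {i j m} → i ℕ.+ j ≡ m → i ≤ m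
  left≤ {i} {j} e = subst (i ≤_) e (ℕP.m≤m+n i j)

  right≤ : ∀ {i j m} → i ℕ.+ j ≡ m → j ≤ m
  right≤ {i} {j} e = subst (j ≤_) e (ℕP.m≤n+m j i)

  total-suc : ∀ p (n : Fin (suc p) → ℕ) → total (suc p) n ≡ n zero ℕ.+ total p (n ∘ suc)
  total-suc p n = cong sum (map-allFin p n)

  component≤total : ∀ p (n : Fin p → ℕ) j → n j ≤ total p n
  component≤total (suc p) n zero =
    subst (n zero ≤_) (sym (total-suc p n)) (ℕP.m≤m+n _ _)
  component≤total (suc p) n (suc j) =
    subst (n (suc j) ≤_) (sym (total-suc p n)) (ℕP.≤-trans (component≤total p (n ∘ suc) j) (ℕP.m≤n+m _ _))

  separatedFamilies≡F : ∀ p (n : Fin p → ℕ) m → (∀ i → s ℕ.* m ℕ.+ 1 ≤ n i) →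
                        + separatedFamilies p n m ≡ F (+ total p n) m
  separatedFamilies≡F zero n zero h = refl
  separatedFamilies≡F zero n (suc m) h = sym (F-vanishes-at-0 s≥1 m)
  separatedFamilies≡F (suc p) n m h = begin
    + separatedFamilies (suc p) n m
      ≡⟨ cong +_ (separatedFamilies-step p n m) ⟩
    + convℕ (cycleCount (n zero)) (separatedFamilies p (n ∘ suc)) m
      ≡⟨ convℕ-to-ℤ _ _ m ⟩
    conv (λ i → + cycleCount (n zero) i) (λ j → + separatedFamilies p (n ∘ suc) j) m
      ≡⟨ conv-cong _ _ _ _ m termwise ⟩
    conv (F (+ n zero)) (F (+ total p (n ∘ suc))) m
      ≡⟨ F-vandermonde s≥1 (n zero) (total p (n ∘ suc)) m ⟩
    F (+ (n zero ℕ.+ total p (n ∘ suc))) m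
      ≡⟨ cong (λ t → F (+ t) m) (total-suc p n) ⟨
    F (+ total (suc p) n) m ∎
    where
    termwise : ∀ i j → i ℕ.+ j ≡ m →
               + cycleCount (n zero) i * + separatedFamilies p (n ∘ suc) j ≡ F (+ n zero) i * F (+ total p (n ∘ suc)) j
    termwise i j e =
      cong₂ _*_ (cycleCount≡F (n zero) i (ℕP.≤-trans (room-mono (left≤ e)) (h zero)))
                (separatedFamilies≡F p (n ∘ suc) j (λ q → ℕP.≤-trans (room-mono (right≤ e)) (h (suc q))))

  pointedFamilies≡G : ∀ p (n : Fin p → ℕ) j a k → s ℕ.* k ℕ.+ 1 ≤ n j → (∀ i → s ℕ.* k ≤ n i) →
                      + pointedFamilies p n j a k ≡ G (+ total p n) k
  pointedFamilies≡G (suc p) n zero a k room-j room = begin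
    + pointedFamilies (suc p) n zero a k
      ≡⟨ cong +_ (pointedFamilies-step-here p n a k) ⟩
    + convℕ (pointedCount (n zero) a) (separatedFamilies p (n ∘ suc)) k
      ≡⟨ convℕ-to-ℤ _ _ k ⟩
    conv (λ i → + pointedCount (n zero) a i) (λ l → + separatedFamilies p (n ∘ suc) l) k
      ≡⟨ conv-cong _ _ _ _ k termwise ⟩
    conv (G (+ n zero)) (F (+ total p (n ∘ suc))) k
      ≡⟨ G-vandermonde s≥1 (n zero) (total p (n ∘ suc)) k ⟩
    G (+ (n zero ℕ.+ total p (n ∘ suc))) k
      ≡⟨ cong (λ t → G (+ t) k) (total-suc p n) ⟨
    G (+ total (suc p) n) k ∎
    where
    termwise : ∀ i l → i ℕ.+ l ≡ k →
               + pointedCount (n zero) a i * + separatedFamilies p (n ∘ suc) l ≡ G (+ n zero) i * F (+ total p (n ∘ suc)) l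
    termwise zero l e = cong (λ t → + t * + separatedFamilies p (n ∘ suc) l) (pointedCount-0 (n zero) a)
    termwise (suc i) l e =
      cong₂ _*_ (pointedCount≡G (n zero) a (suc i) (ℕP.≤-trans (room-mono (left≤ e)) room-j))
                (separatedFamilies≡F p (n ∘ suc) l (λ q → ℕP.≤-trans (room-strict l<k) (room (suc q))))
      where
      l<k : l ℕ.< k
      l<k = subst (suc l ≤_) e (s≤s (ℕP.m≤n+m l i))
  pointedFamilies≡G (suc p) n (suc j) a k room-j room = begin
    + pointedFamilies (suc p) n (suc j) a k
      ≡⟨ cong +_ (pointedFamilies-step-later p n j a k) ⟩
    + convℕ (cycleCount (n zero)) (pointedFamilies p (n ∘ suc) j a) k
      ≡⟨ convℕ-to-ℤ _ _ k ⟩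
    conv (λ i → + cycleCount (n zero) i) (λ l → + pointedFamilies p (n ∘ suc) j a l) k
      ≡⟨ conv-cong _ _ _ _ k termwise ⟩
    conv (F (+ n zero)) (G (+ total p (n ∘ suc))) k
      ≡⟨ conv-comm (F (+ n zero)) (G (+ total p (n ∘ suc))) k ⟩
    conv (G (+ total p (n ∘ suc))) (F (+ n zero)) k
      ≡⟨ G-vandermonde s≥1 (total p (n ∘ suc)) (n zero) k ⟩
    G (+ (total p (n ∘ suc) ℕ.+ n zero)) k
      ≡⟨ cong (λ t → G (+ t) k) (trans (ℕP.+-comm _ (n zero)) (sym (total-suc p n))) ⟩
    G (+ total (suc p) n) k ∎
    where
    termwise : ∀ i l → i ℕ.+ l ≡ k →
               + cycleCount (n zero) i * + pointedFamilies p (n ∘ suc) j a l ≡ F (+ n zero) i * G (+ total p (n ∘ suc)) l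
    termwise i zero e =
      trans (cong (λ t → + cycleCount (n zero) i * + t) (pointedFamilies-0 p (n ∘ suc) j a))
            (trans (ℤP.*-zeroʳ (+ cycleCount (n zero) i)) (sym (ℤP.*-zeroʳ (F (+ n zero) i))))
    termwise i (suc l) e =
      cong₂ _*_ (cycleCount≡F (n zero) i (ℕP.≤-trans (room-strict i<k) (room zero)))
                (pointedFamilies≡G p (n ∘ suc) j a (suc l) (ℕP.≤-trans (room-mono (right≤ e)) room-j)
                                   (λ q → ℕP.≤-trans (ℕP.*-monoʳ-≤ s (right≤ e)) (room (suc q))))
      where
      i<k : i ℕ.< k
      i<k = subst (suc i ≤_) (trans (sym (ℕP.+-suc i l)) e) (s≤s (ℕP.m≤m+n i l))

  length-𝒜 : ∀ k p n j a → length (𝒜 s k p n j a) ≡ pointedFamilies p n j a k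
  length-𝒜 k p n j a =
    trans (length-filter _ (allFamilies p n))
          (trans (sum-allFamilies p n _) (sumFamilies-cong p n _ _ bracket))
    where
    bracket : ∀ A → 𝟙 ((separated s A ∧ (card A ≡ᵇ k)) ∧ member j a A)
                    ≡ 𝟙 (separated s A ∧ member j a A) ℕ.* 𝟙 (card A ≡ᵇ k)
    bracket A = trans (cong 𝟙 (∧-swap (separated s A) (card A ≡ᵇ k) (member j a A)))
                      (𝟙-∧ (separated s A ∧ member j a A) (card A ≡ᵇ k))

open import Defs
open import Data.Nat using (ℕ; zero; suc; _≤_; _*_; _∸_; _+_)
open import Data.Nat.Combinatorics using (_C_)
open import Data.Fin using (Fin)
open import Data.List using (length)
open import Relation.Binary.PropositionalEquality using (_≡_; cong; trans; module ≡-Reasoning)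
import Data.Nat.Properties as ℕP
import Data.Integer.Properties as ℤP
open Binomial using (choose; choose≡C)

corollary1 : (s k p : ℕ) (n : Fin p → ℕ) (j : Fin p) (a : Fin (n j)) →
    1 ≤ s → 1 ≤ k → 1 ≤ p →
    (∀ i → 1 ≤ n i) →
    s * k + 1 ≤ n j →
    (∀ i → s * k ≤ n i) →
    length (𝒜 s k p n j a) ≡ (total p n ∸ s * k ∸ 1) C (k ∸ 1)
corollary1 s zero p n j a _ () _ _ _ _
corollary1 s (suc k) p n j a s≥1 _ _ _ room-j room = begin
  length (𝒜 s (suc k) p n j a)       ≡⟨ length-𝒜 (suc k) p n j a ⟩
  pointedFamilies p n j a (suc k)    ≡⟨ ℤP.+-injective (trans (pointedFamilies≡G p n j a (suc k) room-j room)
                                                              (G-value N k Q N≡X+Q+1)) ⟩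
  choose Q k                         ≡⟨ choose≡C Q k ⟩
  Q C k                              ≡⟨ cong (_C k) (ℕP.∸-+-assoc N X 1) ⟨
  (N ∸ X ∸ 1) C k                    ∎
  where
  open ≡-Reasoning
  open Assembly s s≥1
  N = total p n
  X = s * suc k
  Q = N ∸ (X + 1)
  N≡X+Q+1 = split-above X N (ℕP.≤-trans room-j (component≤total p n j))
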